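{- Let $C$ be a binary linear $[n,k]$ code and let $f\in\mathrm{Harm}_d$ be a harmonic function of degree $d$. Then \[ Z_{C,f}(x,y)=(-1)^{d}(x-y)^{k-d}\,y^{n-k-d}\;T\!\left(M_C,f;\frac{x+y}{x-y},\frac{x}{y}\right). \]
   Context: $E=\{1,\dots,n\}$ and $E_d$ is the set of $d$-element subsets of $E$. For $f:E_d\to\mathbb{R}$, $\widetilde f(X):=\sum_{Z\in E_d,\,Z\subset X}f(Z)$ for $X\subset E$. $\mathrm{Harm}_d$ is the set of $f:E_d\to\mathbb{R}$ with $\sum_{Z\in E_d,\,Z\supset Y}f(Z)=0$ for every $(d-1)$-subset $Y\subset E$. For $\mathbf u\in\mathbb{F}_2^n$, $\mathrm{wt}(\mathbf u)=|\mathrm{supp}(\mathbf u)|$ and $\widetilde f(\mathbf u):=\widetilde f(\mathrm{supp}(\mathbf u))$. With $A_{i,f}:=\sum_{\mathbf u\in C,\,\mathrm{wt}(\mathbf u)=i}\widetilde f(\mathbf u)$, the harmonic weight enumerator is $W_{C,f}(x,y)=\sum_iA_{i,f}x^{n-i}y^i$ and $Z_{C,f}(x,y):=\sum_{i=0}^nA_{i,f}x^{n-i-d}y^{i-d}$ (so $W_{C,f}=(xy)^dZ_{C,f}$). $M_C$ is the matroid on $E$ whose independent sets are the index sets of linearly independent columns of a generator matrix of $C$, with rank function $\rho$. The harmonic Tutte polynomial is $T(M,f;x,y):=\sum_{J\subset E}\widetilde f(J)(x-1)^{\rho(E)-\rho(J)}(y-1)^{|J|-\rho(J)}$.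
   Formalization: The harmonic function f takes values in ℚ rather than in ℝ. -}

module Defs where

open import Data.Bool using (Bool; true; false; _∧_; _∨_; not; _xor_; if_then_else_)
open import Data.Nat as ℕ using (ℕ; zero; suc; _∸_; _≡ᵇ_)
open import Data.Integer as ℤ using (ℤ; +_; -[1+_])
open import Data.Rational using (ℚ; 0ℚ; 1ℚ; _+_; _*_; -_; 1/_; _≟_; ≢-nonZero)
open import Data.List using (List; []; _∷_; map; foldr; concatMap; allFin)
open import Data.Vec as V using (Vec; []; _∷_; lookup; zipWith; replicate)
open import Data.Fin using (Fin)
open import Relation.Nullary using (yes; no)
open import Relation.Binary.PropositionalEquality using (_≡_)

-- Elements of F₂ are Bool (true = 1, xor = addition, ∧ = multiplication).
-- A vector u ∈ F₂ⁿ is a Vec Bool n; a subset X ⊆ E = {1..n} is its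
-- indicator vector Vec Bool n.  Hence supp(u) is u itself.

allVecs : (n : ℕ) → List (Vec Bool n)
allVecs zero    = [] ∷ []
allVecs (suc n) = concatMap (λ v → (false ∷ v) ∷ (true ∷ v) ∷ []) (allVecs n)

filter : ∀ {A : Set} → (A → Bool) → List A → List A
filter p []       = []
filter p (x ∷ xs) = if p x then x ∷ filter p xs else filter p xs

allL : ∀ {A : Set} → (A → Bool) → List A → Bool
allL p []       = true
allL p (x ∷ xs) = p x ∧ allL p xs

card : ∀ {n} → Vec Bool n → ℕ
card []          = 0
card (true ∷ v)  = suc (card v)
card (false ∷ v) = card v

_⊆ᵇ_ : ∀ {n} → Vec Bool n → Vec Bool n → Bool
[]      ⊆ᵇ []      = true
(a ∷ u) ⊆ᵇ (b ∷ v) = (not a ∨ b) ∧ (u ⊆ᵇ v)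

isZeroᵇ : ∀ {n} → Vec Bool n → Bool
isZeroᵇ []      = true
isZeroᵇ (a ∷ v) = not a ∧ isZeroᵇ v

sumℚ : List ℚ → ℚ
sumℚ = foldr _+_ 0ℚ

_^_ : ℚ → ℕ → ℚ
q ^ zero  = 1ℚ
q ^ suc m = q * (q ^ m)

-- total inverse (value at 0 irrelevant: only used at nonzero arguments)
inv : ℚ → ℚ
inv q with q ≟ 0ℚ
... | yes _  = 0ℚ
... | no q≢0 = 1/_ q {{≢-nonZero q≢0}}

_÷'_ : ℚ → ℚ → ℚ
p ÷' q = p * inv q

_^ℤ_ : ℚ → ℤ → ℚ
q ^ℤ (+ m)      = q ^ m
q ^ℤ -[1+ m ]   = inv q ^ suc m

-- Harmonic functions.  f : E_d → ℚ is given as a function on all subsets,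
-- only its values on d-subsets are ever used.

ftilde : ∀ {n} (d : ℕ) → (Vec Bool n → ℚ) → Vec Bool n → ℚ
ftilde {n} d f X =
  sumℚ (map f (filter (λ Z → (card Z ≡ᵇ d) ∧ (Z ⊆ᵇ X)) (allVecs n)))

IsHarmonic : ∀ {n} (d : ℕ) → (Vec Bool n → ℚ) → Set
IsHarmonic {n} d f =
  (Y : Vec Bool n) → suc (card Y) ≡ d →
  sumℚ (map f (filter (λ Z → (card Z ≡ᵇ d) ∧ (Y ⊆ᵇ Z)) (allVecs n))) ≡ 0ℚ

-- Binary linear codes via a k × n generator matrix G (k rows of length n).

encode : ∀ {k n} → Vec (Vec Bool n) k → Vec Bool k → Vec Bool n
encode []       []       = replicate _ false
encode (r ∷ G) (a ∷ m) =
  if a then zipWith _xor_ r (encode G m) else encode G m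

-- the rows of G are linearly independent over F₂ (so C = {mG} is an [n,k] code)
RowsIndependent : ∀ {k n} → Vec (Vec Bool n) k → Set
RowsIndependent {k} {n} G = (m : Vec Bool k) → encode G m ≡ replicate n false → m ≡ replicate k false

-- the codewords of C, each listed exactly once (given RowsIndependent)
codewords : ∀ {k n} → Vec (Vec Bool n) k → List (Vec Bool n)
codewords {k} G = map (encode G) (allVecs k)

parity : ∀ {n} → Vec Bool n → Bool
parity = V.foldr _ _xor_ false

-- G·c ∈ F₂ᵏ : the linear combination Σ_j c_j (column j of G)
colCombo : ∀ {k n} → Vec (Vec Bool n) k → Vec Bool n → Vec Bool k
colCombo G c = V.map (λ r → parity (zipWith _∧_ r c)) G

-- J is independent in M_C : the columns indexed by J are linearly independent
independentᵇ : ∀ {k n} → Vec (Vec Bool n) k → Vec Bool n → Bool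
independentᵇ {n = n} G J =
  allL (λ c → not (c ⊆ᵇ J) ∨ not (isZeroᵇ (colCombo G c)) ∨ isZeroᵇ c) (allVecs n)

maxℕ : List ℕ → ℕ
maxℕ = foldr ℕ._⊔_ 0

rank : ∀ {k n} → Vec (Vec Bool n) k → Vec Bool n → ℕ
rank {n = n} G J =
  maxℕ (map card (filter (λ I → (I ⊆ᵇ J) ∧ independentᵇ G I) (allVecs n)))

harmTutte : ∀ {k n} → Vec (Vec Bool n) k → (d : ℕ) → (Vec Bool n → ℚ) → ℚ → ℚ → ℚ
harmTutte {n = n} G d f X Y =
  sumℚ (map (λ J → ftilde d f J
                   * ((X + - 1ℚ) ^ (rank G (replicate n true) ∸ rank G J))
                   * ((Y + - 1ℚ) ^ (card J ∸ rank G J)))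
            (allVecs n))

Acoef : ∀ {k n} → Vec (Vec Bool n) k → (d : ℕ) → (Vec Bool n → ℚ) → ℕ → ℚ
Acoef G d f i = sumℚ (map (ftilde d f) (filter (λ u → card u ≡ᵇ i) (codewords G)))

Zpoly : ∀ {k n} → Vec (Vec Bool n) k → (d : ℕ) → (Vec Bool n → ℚ) → ℚ → ℚ → ℚ
Zpoly {n = n} G d f x y =
  sumℚ (map (λ i → Acoef G d f i
                   * (x ^ℤ ((+ n) ℤ.- (+ i) ℤ.- (+ d)))
                   * (y ^ℤ ((+ i) ℤ.- (+ d))))
            (map (λ (j : Fin (suc n)) → Data.Fin.toℕ j) (allFin (suc n))))

{-# OPTIONS --safe #-}
-- Put a = x − y, so that X − 1 = 2y/a and Y − 1 = a/y at X = (x+y)/(x−y), Y = x/y. After multiplying by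
-- the prefactor, the J-th term of the harmonic Tutte polynomial becomes 2^(k−ρ(J)) (−1)^d f̃(J) a^(|J|−d) y^(n−d−|J|).
-- Since ρ(E) = k, 2^(k−ρ(J)) is the number of codewords vanishing on J: summing the characters
-- (−1)^(mG·c) over messages m and subsets c ⊆ J in both orders gives 2^|J| N(J) = 2^k #{c ⊆ J : Gc = 0},
-- and a maximal independent I ⊆ J has N(J) = N(I) = 2^(k−|I|). Exchanging the sums, the Tutte side becomes
-- Σ_{u ∈ C} (−1)^d Σ_{J ⊆ E∖u} f̃(J) a^(|J|−d) y^(n−d−|J|), and the binomial theorem evaluates the inner sum
-- to f̃(E∖u) x^(|E∖u|−d) y^(|u|−d). Finally, for harmonic f, inclusion–exclusion gives f̃(E∖u) = (−1)^d f̃(u),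
-- because the sums of f over the d-sets containing a fixed set of size below d all vanish.

module Submission where

open import Defs
open import Data.Bool using (Bool; true; false; _∧_; _∨_; not; _xor_; if_then_else_; T)
import Data.Bool.Properties as 𝔹
open import Data.Nat as ℕ using (ℕ; zero; suc; _∸_; _≡ᵇ_; _⊔_; z≤n; s≤s)
import Data.Nat.Properties as ℕP
open import Data.Integer as ℤ using (ℤ; +_; -[1+_]; _⊖_)
import Data.Integer.Properties as ℤP
import Data.Integer.Solver as ℤSolver
open import Data.Rational using (ℚ; 0ℚ; 1ℚ; _+_; _*_; _-_; -_; _<_; _≟_; ≢-nonZero)
open import Data.Rational.Properties as ℚP
  using (+-identityˡ; +-identityʳ; *-identityˡ; *-identityʳ; +-assoc; +-comm; *-assoc; *-comm; *-zeroˡ; *-zeroʳ; *-distribˡ-+)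
import Data.Rational.Solver as ℚSolver
open import Data.List using (List; []; _∷_; map; foldr; concatMap; tabulate; allFin)
import Data.List.Properties as ListP
open import Function using (_∘_; id)
open import Algebra.Bundles using (CommutativeRing)
open import Algebra.Properties.CommutativeSemigroup (CommutativeRing.+-commutativeSemigroup 𝔹.xor-∧-commutativeRing) using (interchange)
open import Data.Vec as V using (Vec; []; _∷_; zipWith; replicate; lookup)
open import Data.Fin using (Fin; zero; suc; toℕ)
open import Data.Product using (∃; ∃₂; _,_; _×_)
open import Data.Sum using (inj₁; inj₂)
open import Data.Empty using (⊥-elim)
open import Relation.Binary using (tri<; tri≈; tri>)
open import Relation.Binary.PropositionalEquality
open import Relation.Nullary using (yes; no)

open ℚSolver.+-*-Solver using (solve; _:=_; _:+_; _:*_; :-_; con)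
private module ℤS = ℤSolver.+-*-Solver

2ℚ : ℚ
2ℚ = 1ℚ + 1ℚ

fromℕ : ℕ → ℚ
fromℕ zero    = 0ℚ
fromℕ (suc m) = 1ℚ + fromℕ m

inv-inverseʳ : ∀ q → q ≢ 0ℚ → q * inv q ≡ 1ℚ
inv-inverseʳ q q≢0 with q ≟ 0ℚ
... | yes q≡0  = ⊥-elim (q≢0 q≡0)
... | no  q≢0′ = ℚP.*-inverseʳ q {{≢-nonZero q≢0′}}

*-cancelˡ-≢0 : ∀ c {p q} → c ≢ 0ℚ → c * p ≡ c * q → p ≡ q
*-cancelˡ-≢0 c {p} {q} c≢0 cp≡cq = begin
  p               ≡⟨ *-identityˡ p ⟨
  1ℚ * p          ≡⟨ cong (_* p) c⁻¹c≡1 ⟨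
  (inv c * c) * p ≡⟨ *-assoc (inv c) c p ⟩
  inv c * (c * p) ≡⟨ cong (inv c *_) cp≡cq ⟩
  inv c * (c * q) ≡⟨ *-assoc (inv c) c q ⟨
  (inv c * c) * q ≡⟨ cong (_* q) c⁻¹c≡1 ⟩
  1ℚ * q          ≡⟨ *-identityˡ q ⟩
  q               ∎
  where
  open ≡-Reasoning
  c⁻¹c≡1 : inv c * c ≡ 1ℚ
  c⁻¹c≡1 = trans (*-comm (inv c) c) (inv-inverseʳ c c≢0)

positive⇒≢0 : ∀ {q} → 0ℚ < q → q ≢ 0ℚ
positive⇒≢0 0<q q≡0 = ℚP.<-irrefl (sym q≡0) 0<q

0<1 : 0ℚ < 1ℚ
0<1 = ℚP.positive⁻¹ 1ℚ

+-pos : ∀ {p q} → 0ℚ < p → 0ℚ < q → 0ℚ < p + q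
+-pos 0<p 0<q = ℚP.<-respˡ-≡ (+-identityʳ 0ℚ) (ℚP.+-mono-< 0<p 0<q)

fromℕ-suc-pos : ∀ m → 0ℚ < fromℕ (suc m)
fromℕ-suc-pos zero    = ℚP.<-respʳ-≡ (sym (+-identityʳ 1ℚ)) 0<1
fromℕ-suc-pos (suc m) = +-pos 0<1 (fromℕ-suc-pos m)

q+q≡2q : ∀ q → q + q ≡ 2ℚ * q
q+q≡2q = solve 1 (λ q → q :+ q := (con 1ℚ :+ con 1ℚ) :* q) refl

^-distribˡ-+-* : ∀ q a b → q ^ (a ℕ.+ b) ≡ q ^ a * q ^ b
^-distribˡ-+-* q zero    b = sym (*-identityˡ _)
^-distribˡ-+-* q (suc a) b = trans (cong (q *_) (^-distribˡ-+-* q a b)) (sym (*-assoc q _ _))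

^-distribʳ-* : ∀ p q a → (p * q) ^ a ≡ p ^ a * q ^ a
^-distribʳ-* p q zero    = refl
^-distribʳ-* p q (suc a) = trans (cong ((p * q) *_) (^-distribʳ-* p q a))
  (solve 4 (λ p q x y → (p :* q) :* (x :* y) := (p :* x) :* (q :* y)) refl p q (p ^ a) (q ^ a))

1^n≡1 : ∀ n → 1ℚ ^ n ≡ 1ℚ
1^n≡1 zero    = refl
1^n≡1 (suc n) = cong (1ℚ *_) (1^n≡1 n)

[-1]^n*[-1]^n≡1 : ∀ n → (- 1ℚ) ^ n * (- 1ℚ) ^ n ≡ 1ℚ
[-1]^n*[-1]^n≡1 n = trans (sym (^-distribʳ-* (- 1ℚ) (- 1ℚ) n)) (1^n≡1 n)

2^-pos : ∀ a → 0ℚ < 2ℚ ^ a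
2^-pos zero    = 0<1
2^-pos (suc a) = ℚP.<-respʳ-≡ (q+q≡2q (2ℚ ^ a)) (+-pos (2^-pos a) (2^-pos a))

2^-<-suc : ∀ a → 2ℚ ^ a < 2ℚ ^ suc a
2^-<-suc a = ℚP.<-respˡ-≡ (+-identityʳ (2ℚ ^ a))
  (ℚP.<-respʳ-≡ (q+q≡2q (2ℚ ^ a)) (ℚP.+-monoʳ-< (2ℚ ^ a) (2^-pos a)))

2^-mono-< : ∀ {a b} → a ℕ.< b → 2ℚ ^ a < 2ℚ ^ b
2^-mono-< {a} {suc b} a<1+b with ℕP.m<1+n⇒m<n∨m≡n a<1+b
... | inj₁ a<b  = ℚP.<-trans (2^-mono-< a<b) (2^-<-suc b)
... | inj₂ refl = 2^-<-suc a

2^-injective : ∀ a b → 2ℚ ^ a ≡ 2ℚ ^ b → a ≡ b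
2^-injective a b 2^a≡2^b with ℕP.<-cmp a b
... | tri< a<b _ _ = ⊥-elim (ℚP.<-irrefl 2^a≡2^b (2^-mono-< a<b))
... | tri≈ _ a≡b _ = a≡b
... | tri> _ _ b<a = ⊥-elim (ℚP.<-irrefl (sym 2^a≡2^b) (2^-mono-< b<a))

^ℤ-⊖ : ∀ q → q ≢ 0ℚ → ∀ p r → q ^ℤ (p ⊖ r) ≡ q ^ p * inv q ^ r
^ℤ-⊖ q q≢0 p       zero    = sym (*-identityʳ _)
^ℤ-⊖ q q≢0 zero    (suc r) = sym (*-identityˡ _)
^ℤ-⊖ q q≢0 (suc p) (suc r) = begin
  q ^ℤ (suc p ⊖ suc r)              ≡⟨ cong (q ^ℤ_) (ℤP.[1+m]⊖[1+n]≡m⊖n p r) ⟩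
  q ^ℤ (p ⊖ r)                      ≡⟨ ^ℤ-⊖ q q≢0 p r ⟩
  q ^ p * inv q ^ r                 ≡⟨ *-identityˡ _ ⟨
  1ℚ * (q ^ p * inv q ^ r)          ≡⟨ cong (_* (q ^ p * inv q ^ r)) (inv-inverseʳ q q≢0) ⟨
  (q * inv q) * (q ^ p * inv q ^ r) ≡⟨ solve 4 (λ a b c d → (a :* b) :* (c :* d) := (a :* c) :* (b :* d)) refl q (inv q) (q ^ p) (inv q ^ r) ⟩
  q ^ suc p * inv q ^ suc r         ∎
  where open ≡-Reasoning

⊖-surjective : ∀ i → ∃₂ λ p r → i ≡ p ⊖ r
⊖-surjective (+ p)    = p , 0 , refl
⊖-surjective -[1+ r ] = 0 , suc r , refl

⊖-+-⊖ : ∀ p₁ r₁ p₂ r₂ → (p₁ ⊖ r₁) ℤ.+ (p₂ ⊖ r₂) ≡ (p₁ ℕ.+ p₂) ⊖ (r₁ ℕ.+ r₂)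
⊖-+-⊖ p₁ r₁ p₂ r₂ = begin
  (p₁ ⊖ r₁) ℤ.+ (p₂ ⊖ r₂)             ≡⟨ cong₂ ℤ._+_ (ℤP.m-n≡m⊖n p₁ r₁) (ℤP.m-n≡m⊖n p₂ r₂) ⟨
  (+ p₁ ℤ.- + r₁) ℤ.+ (+ p₂ ℤ.- + r₂) ≡⟨ ℤS.solve 4 (λ a b c d → (a ℤS.:- b) ℤS.:+ (c ℤS.:- d) ℤS.:= (a ℤS.:+ c) ℤS.:- (b ℤS.:+ d)) refl (+ p₁) (+ r₁) (+ p₂) (+ r₂) ⟩
  (+ p₁ ℤ.+ + p₂) ℤ.- (+ r₁ ℤ.+ + r₂) ≡⟨ ℤP.m-n≡m⊖n (p₁ ℕ.+ p₂) (r₁ ℕ.+ r₂) ⟩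
  (p₁ ℕ.+ p₂) ⊖ (r₁ ℕ.+ r₂)           ∎
  where open ≡-Reasoning

^ℤ-distribˡ-+-* : ∀ q → q ≢ 0ℚ → ∀ i j → q ^ℤ (i ℤ.+ j) ≡ q ^ℤ i * q ^ℤ j
^ℤ-distribˡ-+-* q q≢0 i j with ⊖-surjective i | ⊖-surjective j
... | p₁ , r₁ , refl | p₂ , r₂ , refl = begin
  q ^ℤ ((p₁ ⊖ r₁) ℤ.+ (p₂ ⊖ r₂))                ≡⟨ cong (q ^ℤ_) (⊖-+-⊖ p₁ r₁ p₂ r₂) ⟩
  q ^ℤ ((p₁ ℕ.+ p₂) ⊖ (r₁ ℕ.+ r₂))              ≡⟨ ^ℤ-⊖ q q≢0 (p₁ ℕ.+ p₂) (r₁ ℕ.+ r₂) ⟩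
  q ^ (p₁ ℕ.+ p₂) * inv q ^ (r₁ ℕ.+ r₂)         ≡⟨ cong₂ _*_ (^-distribˡ-+-* q p₁ p₂) (^-distribˡ-+-* (inv q) r₁ r₂) ⟩
  (q ^ p₁ * q ^ p₂) * (inv q ^ r₁ * inv q ^ r₂) ≡⟨ solve 4 (λ a b c d → (a :* b) :* (c :* d) := (a :* c) :* (b :* d)) refl (q ^ p₁) (q ^ p₂) (inv q ^ r₁) (inv q ^ r₂) ⟩
  (q ^ p₁ * inv q ^ r₁) * (q ^ p₂ * inv q ^ r₂) ≡⟨ cong₂ _*_ (^ℤ-⊖ q q≢0 p₁ r₁) (^ℤ-⊖ q q≢0 p₂ r₂) ⟨
  q ^ℤ (p₁ ⊖ r₁) * q ^ℤ (p₂ ⊖ r₂)               ∎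
  where open ≡-Reasoning

^ℤ-neg : ∀ q r → q ^ℤ (ℤ.- (+ r)) ≡ inv q ^ r
^ℤ-neg q zero    = refl
^ℤ-neg q (suc r) = refl

∑L : {A : Set} → List A → (A → ℚ) → ℚ
∑L l g = sumℚ (map g l)

module _ {A : Set} where

  ∑L-cong : ∀ (l : List A) {g h : A → ℚ} → (∀ a → g a ≡ h a) → ∑L l g ≡ ∑L l h
  ∑L-cong []      g≗h = refl
  ∑L-cong (x ∷ l) g≗h = cong₂ _+_ (g≗h x) (∑L-cong l g≗h)

  ∑L-0 : ∀ (l : List A) → ∑L l (λ _ → 0ℚ) ≡ 0ℚ
  ∑L-0 []      = refl
  ∑L-0 (x ∷ l) = trans (+-identityˡ _) (∑L-0 l)

  ∑L-+ : ∀ (l : List A) (g h : A → ℚ) → ∑L l (λ a → g a + h a) ≡ ∑L l g + ∑L l h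
  ∑L-+ []      g h = refl
  ∑L-+ (x ∷ l) g h = trans (cong (_+_ (g x + h x)) (∑L-+ l g h))
    (solve 4 (λ a b c d → (a :+ b) :+ (c :+ d) := (a :+ c) :+ (b :+ d)) refl (g x) (h x) (∑L l g) (∑L l h))

  ∑L-*ˡ : ∀ (l : List A) c (g : A → ℚ) → ∑L l (λ a → c * g a) ≡ c * ∑L l g
  ∑L-*ˡ []      c g = sym (*-zeroʳ c)
  ∑L-*ˡ (x ∷ l) c g = trans (cong (_+_ (c * g x)) (∑L-*ˡ l c g)) (sym (*-distribˡ-+ c (g x) (∑L l g)))

  ∑L-*ʳ : ∀ (l : List A) c (g : A → ℚ) → ∑L l (λ a → g a * c) ≡ ∑L l g * c
  ∑L-*ʳ l c g = trans (∑L-cong l (λ a → *-comm (g a) c)) (trans (∑L-*ˡ l c g) (*-comm c _))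

  ∑L-map : ∀ {B : Set} (f : A → B) (l : List A) (g : B → ℚ) → ∑L (map f l) g ≡ ∑L l (g ∘ f)
  ∑L-map f []      g = refl
  ∑L-map f (x ∷ l) g = cong (_+_ (g (f x))) (∑L-map f l g)

∑L-swap : ∀ {A B : Set} (l : List A) (m : List B) (g : A → B → ℚ) →
  ∑L l (λ a → ∑L m (g a)) ≡ ∑L m (λ b → ∑L l (λ a → g a b))
∑L-swap []      m g = sym (∑L-0 m)
∑L-swap (x ∷ l) m g = trans (cong (_+_ (∑L m (g x))) (∑L-swap l m g)) (sym (∑L-+ m (g x) _))

[_]ℚ : Bool → ℚ → ℚ
[ b ]ℚ q = if b then q else 0ℚ

∑L-filter : ∀ {A : Set} (p : A → Bool) (l : List A) (g : A → ℚ) →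
  sumℚ (map g (filter p l)) ≡ ∑L l (λ a → [ p a ]ℚ (g a))
∑L-filter p []      g = refl
∑L-filter p (x ∷ l) g with p x
... | true  = cong (_+_ (g x)) (∑L-filter p l g)
... | false = trans (∑L-filter p l g) (sym (+-identityˡ _))

∑L-tabulate-suc : ∀ m (g : ℕ → ℚ) → ∑L (tabulate {n = m} (suc ∘ toℕ)) g ≡ ∑L (tabulate {n = m} toℕ) (g ∘ suc)
∑L-tabulate-suc m g =
  trans (cong (λ l → ∑L l g) (sym (ListP.map-tabulate {n = m} toℕ suc))) (∑L-map suc (tabulate {n = m} toℕ) g)

∑L-upTo-delta : ∀ m w → w ℕ.< m → (g : ℕ → ℚ) →
  ∑L (tabulate {n = m} toℕ) (λ i → [ w ≡ᵇ i ]ℚ (g i)) ≡ g w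
∑L-upTo-delta (suc m) zero    _         g = begin
  g 0 + ∑L (tabulate {n = m} (suc ∘ toℕ)) (λ i → [ 0 ≡ᵇ i ]ℚ (g i)) ≡⟨ cong (_+_ (g 0)) (∑L-tabulate-suc m _) ⟩
  g 0 + ∑L (tabulate {n = m} toℕ) (λ _ → 0ℚ)                       ≡⟨ cong (_+_ (g 0)) (∑L-0 (tabulate {n = m} toℕ)) ⟩
  g 0 + 0ℚ                                                 ≡⟨ +-identityʳ (g 0) ⟩
  g 0                                                      ∎
  where open ≡-Reasoning
∑L-upTo-delta (suc m) (suc w) (s≤s w<m) g = begin
  0ℚ + ∑L (tabulate {n = m} (suc ∘ toℕ)) (λ i → [ suc w ≡ᵇ i ]ℚ (g i)) ≡⟨ +-identityˡ _ ⟩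
  ∑L (tabulate {n = m} (suc ∘ toℕ)) (λ i → [ suc w ≡ᵇ i ]ℚ (g i))      ≡⟨ ∑L-tabulate-suc m _ ⟩
  ∑L (tabulate {n = m} toℕ) (λ i → [ w ≡ᵇ i ]ℚ (g (suc i)))           ≡⟨ ∑L-upTo-delta m w w<m (g ∘ suc) ⟩
  g (suc w)                                                  ∎
  where open ≡-Reasoning

-- Opaque, so that goals show ∑ n g rather than an unfolded list of all 2ⁿ vectors.
opaque
  ∑ : (n : ℕ) → (Vec Bool n → ℚ) → ℚ
  ∑ n = ∑L (allVecs n)

opaque
  unfolding ∑

  ∑-unfold : ∀ n g → ∑ n g ≡ ∑L (allVecs n) g
  ∑-unfold n g = refl

  ∑-[] : ∀ (g : Vec Bool 0 → ℚ) → ∑ 0 g ≡ g []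
  ∑-[] g = +-identityʳ (g [])

  ∑-∷ : ∀ n (g : Vec Bool (suc n) → ℚ) → ∑ (suc n) g ≡ ∑ n (g ∘ (false ∷_)) + ∑ n (g ∘ (true ∷_))
  ∑-∷ n g = trans (split (allVecs n)) (∑L-+ (allVecs n) _ _)
    where
    split : ∀ l → ∑L (concatMap (λ v → (false ∷ v) ∷ (true ∷ v) ∷ []) l) g
                ≡ ∑L l (λ v → g (false ∷ v) + g (true ∷ v))
    split []      = refl
    split (v ∷ l) = trans (cong (λ s → g (false ∷ v) + (g (true ∷ v) + s)) (split l))
                          (sym (+-assoc (g (false ∷ v)) (g (true ∷ v)) _))

  ∑-cong : ∀ n {g h : Vec Bool n → ℚ} → (∀ a → g a ≡ h a) → ∑ n g ≡ ∑ n h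
  ∑-cong n = ∑L-cong (allVecs n)

  ∑-0 : ∀ n → ∑ n (λ _ → 0ℚ) ≡ 0ℚ
  ∑-0 n = ∑L-0 (allVecs n)

  ∑-*ˡ : ∀ n c (g : Vec Bool n → ℚ) → ∑ n (λ a → c * g a) ≡ c * ∑ n g
  ∑-*ˡ n = ∑L-*ˡ (allVecs n)

  ∑-*ʳ : ∀ n c (g : Vec Bool n → ℚ) → ∑ n (λ a → g a * c) ≡ ∑ n g * c
  ∑-*ʳ n = ∑L-*ʳ (allVecs n)

  ∑-swap : ∀ n m (g : Vec Bool n → Vec Bool m → ℚ) →
    ∑ n (λ a → ∑ m (g a)) ≡ ∑ m (λ b → ∑ n (λ a → g a b))
  ∑-swap n m = ∑L-swap (allVecs n) (allVecs m)

∑-vanish : ∀ n {g : Vec Bool n → ℚ} → (∀ a → g a ≡ 0ℚ) → ∑ n g ≡ 0ℚ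
∑-vanish n g≗0 = trans (∑-cong n g≗0) (∑-0 n)

∑-+-∑-neg : ∀ n (g : Vec Bool n → ℚ) → ∑ n g + ∑ n (λ a → - 1ℚ * g a) ≡ 0ℚ
∑-+-∑-neg n g = trans (cong (_+_ (∑ n g)) (∑-*ˡ n (- 1ℚ) g))
  (solve 1 (λ s → s :+ (:- con 1ℚ) :* s := con 0ℚ) refl (∑ n g))

[]-∑ : ∀ n b (g : Vec Bool n → ℚ) → [ b ]ℚ (∑ n g) ≡ ∑ n (λ a → [ b ]ℚ (g a))
[]-∑ n false g = sym (∑-0 n)
[]-∑ n true  g = refl

[]-∧ : ∀ a b q → [ a ∧ b ]ℚ q ≡ [ a ]ℚ ([ b ]ℚ q)
[]-∧ false b q = refl
[]-∧ true  b q = refl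

[]-*ˡ : ∀ b c q → [ b ]ℚ (c * q) ≡ c * [ b ]ℚ q
[]-*ˡ false c q = sym (*-zeroʳ c)
[]-*ˡ true  c q = refl

[]-*ʳ : ∀ b q r → [ b ]ℚ q * r ≡ [ b ]ℚ (q * r)
[]-*ʳ false q r = *-zeroˡ r
[]-*ʳ true  q r = refl

[]-0 : ∀ b → [ b ]ℚ 0ℚ ≡ 0ℚ
[]-0 false = refl
[]-0 true  = refl

[]-∧-false : ∀ b q → [ b ∧ false ]ℚ q ≡ 0ℚ
[]-∧-false false q = refl
[]-∧-false true  q = refl

≡ᵇ-refl : ∀ m → (m ≡ᵇ m) ≡ true
≡ᵇ-refl zero    = refl
≡ᵇ-refl (suc m) = ≡ᵇ-refl m

≡ᵇ⇒≡ : ∀ m k → (m ≡ᵇ k) ≡ true → m ≡ k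
≡ᵇ⇒≡ m k m≡ᵇk = ℕP.≡ᵇ⇒≡ m k (subst T (sym m≡ᵇk) _)

≢⇒≡ᵇ-false : ∀ {m k} → m ≢ k → (m ≡ᵇ k) ≡ false
≢⇒≡ᵇ-false {m} {k} m≢k with m ≡ᵇ k in m≡ᵇk
... | false = refl
... | true  = ⊥-elim (m≢k (≡ᵇ⇒≡ m k m≡ᵇk))

⊆ᵇ⇒card≤ : ∀ {n} (Y Z : Vec Bool n) → Y ⊆ᵇ Z ≡ true → card Y ℕ.≤ card Z
⊆ᵇ⇒card≤ []          []          _   = z≤n
⊆ᵇ⇒card≤ (false ∷ Y) (false ∷ Z) Y⊆Z = ⊆ᵇ⇒card≤ Y Z Y⊆Z
⊆ᵇ⇒card≤ (false ∷ Y) (true ∷ Z)  Y⊆Z = ℕP.m≤n⇒m≤1+n (⊆ᵇ⇒card≤ Y Z Y⊆Z)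
⊆ᵇ⇒card≤ (true ∷ Y)  (true ∷ Z)  Y⊆Z = s≤s (⊆ᵇ⇒card≤ Y Z Y⊆Z)

card≤n : ∀ {n} (v : Vec Bool n) → card v ℕ.≤ n
card≤n []          = z≤n
card≤n (false ∷ v) = ℕP.m≤n⇒m≤1+n (card≤n v)
card≤n (true ∷ v)  = s≤s (card≤n v)

∁ : ∀ {n} → Vec Bool n → Vec Bool n
∁ = V.map not

card-∁ : ∀ {n} (c : Vec Bool n) → card (∁ c) ℕ.+ card c ≡ n
card-∁ []          = refl
card-∁ (false ∷ c) = cong suc (card-∁ c)
card-∁ (true ∷ c)  = trans (ℕP.+-suc _ _) (cong suc (card-∁ c))

∁-involutive : ∀ {n} (c : Vec Bool n) → ∁ (∁ c) ≡ c
∁-involutive []          = refl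
∁-involutive (false ∷ c) = cong (false ∷_) (∁-involutive c)
∁-involutive (true ∷ c)  = cong (true ∷_) (∁-involutive c)

[]-[∧false]∧ : ∀ a c q → [ (a ∧ false) ∧ c ]ℚ q ≡ 0ℚ
[]-[∧false]∧ false c q = refl
[]-[∧false]∧ true  c q = refl

∑-isZero-delta : ∀ n q → ∑ n (λ c → [ isZeroᵇ c ]ℚ q) ≡ q
∑-isZero-delta zero    q = ∑-[] _
∑-isZero-delta (suc n) q =
  trans (∑-∷ n _) (trans (cong₂ _+_ (∑-isZero-delta n q) (∑-0 n)) (+-identityʳ q))

∑-superset-delta : ∀ n (Y : Vec Bool n) (f : Vec Bool n → ℚ) →
  ∑ n (λ Z → [ (card Z ≡ᵇ card Y) ∧ (Y ⊆ᵇ Z) ]ℚ (f Z)) ≡ f Y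
∑-superset-delta zero    [] f = ∑-[] _
∑-superset-delta (suc n) (true ∷ Y) f = trans (∑-∷ n _) (trans (cong₂ _+_
  (∑-vanish n (λ Z → []-∧-false (card Z ≡ᵇ suc (card Y)) _))
  (∑-superset-delta n Y (f ∘ (true ∷_)))) (+-identityˡ _))
∑-superset-delta (suc n) (false ∷ Y) f = trans (∑-∷ n _) (trans (cong₂ _+_
  (∑-superset-delta n Y (f ∘ (false ∷_)))
  (∑-vanish n too-big)) (+-identityʳ _))
  where
  too-big : ∀ Z → [ (suc (card Z) ≡ᵇ card Y) ∧ (Y ⊆ᵇ Z) ]ℚ (f (true ∷ Z)) ≡ 0ℚ
  too-big Z with Y ⊆ᵇ Z in Y⊆Z
  ... | false = []-∧-false (suc (card Z) ≡ᵇ card Y) _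
  ... | true  rewrite ≢⇒≡ᵇ-false (ℕP.>⇒≢ (s≤s (⊆ᵇ⇒card≤ Y Z Y⊆Z))) = refl

#between : ∀ {n} (Y Z : Vec Bool n) (m : ℕ) → ℚ
#between {n} Y Z m = ∑ n (λ W → [ ((Y ⊆ᵇ W) ∧ (W ⊆ᵇ Z)) ∧ (card W ≡ᵇ m) ]ℚ 1ℚ)

#between-bottom : ∀ n (Y Z : Vec Bool n) → #between Y Z (card Y) ≡ [ Y ⊆ᵇ Z ]ℚ 1ℚ
#between-bottom zero    []          []          = ∑-[] _
#between-bottom (suc n) (false ∷ Y) (false ∷ Z) = trans (∑-∷ n _)
  (trans (cong₂ _+_ (#between-bottom n Y Z) (∑-vanish n (λ W → []-[∧false]∧ (Y ⊆ᵇ W) _ 1ℚ))) (+-identityʳ _))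
#between-bottom (suc n) (false ∷ Y) (true ∷ Z)  = trans (∑-∷ n _)
  (trans (cong₂ _+_ (#between-bottom n Y Z) (∑-vanish n too-big)) (+-identityʳ _))
  where
  too-big : ∀ W → [ ((Y ⊆ᵇ W) ∧ (W ⊆ᵇ Z)) ∧ (suc (card W) ≡ᵇ card Y) ]ℚ 1ℚ ≡ 0ℚ
  too-big W with Y ⊆ᵇ W in Y⊆W
  ... | false = refl
  ... | true  rewrite ≢⇒≡ᵇ-false (ℕP.>⇒≢ (s≤s (⊆ᵇ⇒card≤ Y W Y⊆W))) = []-∧-false (W ⊆ᵇ Z) 1ℚ
#between-bottom (suc n) (true ∷ Y)  (false ∷ Z) = trans (∑-∷ n _)
  (trans (cong₂ _+_ (∑-0 n) (∑-vanish n (λ W → []-[∧false]∧ (Y ⊆ᵇ W) _ 1ℚ))) (+-identityʳ _))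
#between-bottom (suc n) (true ∷ Y)  (true ∷ Z)  = trans (∑-∷ n _)
  (trans (cong₂ _+_ (∑-0 n) (#between-bottom n Y Z)) (+-identityˡ _))

#between-next : ∀ n (Y Z : Vec Bool n) → #between Y Z (suc (card Y)) ≡ [ Y ⊆ᵇ Z ]ℚ (fromℕ (card Z ∸ card Y))
#between-next zero    []          []          = ∑-[] _
#between-next (suc n) (false ∷ Y) (false ∷ Z) = trans (∑-∷ n _)
  (trans (cong₂ _+_ (#between-next n Y Z) (∑-vanish n (λ W → []-[∧false]∧ (Y ⊆ᵇ W) _ 1ℚ))) (+-identityʳ _))
#between-next (suc n) (false ∷ Y) (true ∷ Z)  = trans (∑-∷ n _)
  (trans (cong₂ _+_ (#between-next n Y Z) (#between-bottom n Y Z)) add-one)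
  where
  add-one : [ Y ⊆ᵇ Z ]ℚ (fromℕ (card Z ∸ card Y)) + [ Y ⊆ᵇ Z ]ℚ 1ℚ ≡ [ Y ⊆ᵇ Z ]ℚ (fromℕ (suc (card Z) ∸ card Y))
  add-one with Y ⊆ᵇ Z in Y⊆Z
  ... | false = refl
  ... | true  rewrite ℕP.+-∸-assoc 1 (⊆ᵇ⇒card≤ Y Z Y⊆Z) = +-comm (fromℕ (card Z ∸ card Y)) 1ℚ
#between-next (suc n) (true ∷ Y)  (false ∷ Z) = trans (∑-∷ n _)
  (trans (cong₂ _+_ (∑-0 n) (∑-vanish n (λ W → []-[∧false]∧ (Y ⊆ᵇ W) _ 1ℚ))) (+-identityʳ _))
#between-next (suc n) (true ∷ Y)  (true ∷ Z)  = trans (∑-∷ n _)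
  (trans (cong₂ _+_ (∑-0 n) (#between-next n Y Z)) (+-identityˡ _))

inclusion-exclusion : ∀ n (Z K : Vec Bool n) q →
  [ Z ⊆ᵇ K ]ℚ q ≡ ∑ n (λ Y → [ (Y ⊆ᵇ Z) ∧ (Y ⊆ᵇ ∁ K) ]ℚ ((- 1ℚ) ^ card Y * q))
inclusion-exclusion zero    []          []          q = sym (trans (∑-[] _) (*-identityˡ q))
inclusion-exclusion (suc n) (false ∷ Z) (k ∷ K)     q = sym (trans (∑-∷ n _)
  (trans (cong₂ _+_ (sym (inclusion-exclusion n Z K q)) (∑-0 n)) (+-identityʳ _)))
inclusion-exclusion (suc n) (true ∷ Z)  (true ∷ K)  q = sym (trans (∑-∷ n _)
  (trans (cong₂ _+_ (sym (inclusion-exclusion n Z K q)) (∑-vanish n (λ Y → []-∧-false (Y ⊆ᵇ Z) _))) (+-identityʳ _)))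
inclusion-exclusion (suc n) (true ∷ Z)  (false ∷ K) q = sym (trans (∑-∷ n _)
  (trans (cong (_+_ (∑ n term)) (∑-cong n flip-sign)) (∑-+-∑-neg n term)))
  where
  term : Vec Bool n → ℚ
  term Y = [ (Y ⊆ᵇ Z) ∧ (Y ⊆ᵇ ∁ K) ]ℚ ((- 1ℚ) ^ card Y * q)
  flip-sign : ∀ Y → [ (Y ⊆ᵇ Z) ∧ (Y ⊆ᵇ ∁ K) ]ℚ ((- 1ℚ * (- 1ℚ) ^ card Y) * q) ≡ - 1ℚ * term Y
  flip-sign Y = trans (cong [ (Y ⊆ᵇ Z) ∧ (Y ⊆ᵇ ∁ K) ]ℚ (*-assoc (- 1ℚ) ((- 1ℚ) ^ card Y) q))
                      ([]-*ˡ ((Y ⊆ᵇ Z) ∧ (Y ⊆ᵇ ∁ K)) (- 1ℚ) ((- 1ℚ) ^ card Y * q))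

-- Harmonic functions

module Harmonic {n : ℕ} (d : ℕ) (f : Vec Bool n → ℚ) where

  f̃ : Vec Bool n → ℚ
  f̃ K = ∑ n (λ Z → [ (card Z ≡ᵇ d) ∧ (Z ⊆ᵇ K) ]ℚ (f Z))

  ∑⊇ : Vec Bool n → ℚ
  ∑⊇ Y = ∑ n (λ Z → [ (card Z ≡ᵇ d) ∧ (Y ⊆ᵇ Z) ]ℚ (f Z))

  ftilde≡f̃ : ∀ K → ftilde d f K ≡ f̃ K
  ftilde≡f̃ K = trans (∑L-filter (λ Z → (card Z ≡ᵇ d) ∧ (Z ⊆ᵇ K)) (allVecs n) f) (sym (∑-unfold n _))

  isHarmonic⇒∑⊇-vanishes : IsHarmonic d f → ∀ Y → suc (card Y) ≡ d → ∑⊇ Y ≡ 0ℚ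
  isHarmonic⇒∑⊇-vanishes harm Y 1+|Y|≡d = trans (∑-unfold n _)
    (trans (sym (∑L-filter (λ Z → (card Z ≡ᵇ d) ∧ (Y ⊆ᵇ Z)) (allVecs n) f)) (harm Y 1+|Y|≡d))

  -- Each d-set Z ⊇ Y contains exactly d - |Y| sets W ⊇ Y with |W| = |Y| + 1.
  ∑⊇-step : ∀ Y → ∑ n (λ W → [ (Y ⊆ᵇ W) ∧ (card W ≡ᵇ suc (card Y)) ]ℚ (∑⊇ W)) ≡ ∑⊇ Y * fromℕ (d ∸ card Y)
  ∑⊇-step Y = begin
    ∑ n (λ W → [ up W ]ℚ (∑⊇ W))
      ≡⟨ ∑-cong n (λ W → []-∑ n (up W) _) ⟩
    ∑ n (λ W → ∑ n (λ Z → [ up W ]ℚ ([ (card Z ≡ᵇ d) ∧ (W ⊆ᵇ Z) ]ℚ (f Z))))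
      ≡⟨ ∑-swap n n _ ⟩
    ∑ n (λ Z → ∑ n (λ W → [ up W ]ℚ ([ (card Z ≡ᵇ d) ∧ (W ⊆ᵇ Z) ]ℚ (f Z))))
      ≡⟨ ∑-cong n (λ Z → ∑-cong n (λ W → regroup (Y ⊆ᵇ W) (W ⊆ᵇ Z) (card W ≡ᵇ suc (card Y)) (card Z ≡ᵇ d) (f Z))) ⟩
    ∑ n (λ Z → ∑ n (λ W → [ card Z ≡ᵇ d ]ℚ (f Z) * [ ((Y ⊆ᵇ W) ∧ (W ⊆ᵇ Z)) ∧ (card W ≡ᵇ suc (card Y)) ]ℚ 1ℚ))
      ≡⟨ ∑-cong n (λ Z → ∑-*ˡ n ([ card Z ≡ᵇ d ]ℚ (f Z)) _) ⟩
    ∑ n (λ Z → [ card Z ≡ᵇ d ]ℚ (f Z) * #between Y Z (suc (card Y)))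
      ≡⟨ ∑-cong n (λ Z → cong ([ card Z ≡ᵇ d ]ℚ (f Z) *_) (#between-next n Y Z)) ⟩
    ∑ n (λ Z → [ card Z ≡ᵇ d ]ℚ (f Z) * [ Y ⊆ᵇ Z ]ℚ (fromℕ (card Z ∸ card Y)))
      ≡⟨ ∑-cong n count ⟩
    ∑ n (λ Z → [ (card Z ≡ᵇ d) ∧ (Y ⊆ᵇ Z) ]ℚ (f Z) * fromℕ (d ∸ card Y))
      ≡⟨ ∑-*ʳ n _ _ ⟩
    ∑⊇ Y * fromℕ (d ∸ card Y) ∎
    where
    open ≡-Reasoning
    up : Vec Bool n → Bool
    up W = (Y ⊆ᵇ W) ∧ (card W ≡ᵇ suc (card Y))
    regroup : ∀ a b c e q → [ a ∧ c ]ℚ ([ e ∧ b ]ℚ q) ≡ [ e ]ℚ q * [ (a ∧ b) ∧ c ]ℚ 1ℚ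
    regroup false b     c     e     q = sym (*-zeroʳ ([ e ]ℚ q))
    regroup true  false false e     q = sym (*-zeroʳ ([ e ]ℚ q))
    regroup true  true  false e     q = sym (*-zeroʳ ([ e ]ℚ q))
    regroup true  false true  e     q = trans ([]-∧-false e q) (sym (*-zeroʳ ([ e ]ℚ q)))
    regroup true  true  true  false q = sym (*-zeroˡ 1ℚ)
    regroup true  true  true  true  q = sym (*-identityʳ q)
    count : ∀ Z → [ card Z ≡ᵇ d ]ℚ (f Z) * [ Y ⊆ᵇ Z ]ℚ (fromℕ (card Z ∸ card Y))
                ≡ [ (card Z ≡ᵇ d) ∧ (Y ⊆ᵇ Z) ]ℚ (f Z) * fromℕ (d ∸ card Y)
    count Z with card Z ≡ᵇ d in |Z|≡ᵇd
    ... | false = trans (*-zeroˡ ([ Y ⊆ᵇ Z ]ℚ (fromℕ (card Z ∸ card Y)))) (sym (*-zeroˡ (fromℕ (d ∸ card Y))))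
    ... | true with ≡ᵇ⇒≡ (card Z) d |Z|≡ᵇd
    ... | refl with Y ⊆ᵇ Z
    ... | true  = refl
    ... | false = trans (*-zeroʳ (f Z)) (sym (*-zeroˡ (fromℕ (d ∸ card Y))))

  module _ (harm : IsHarmonic d f) where

    -- Downward induction on |Y|, using ∑⊇-step and d - |Y| ≠ 0.
    ∑⊇-vanishes-below : ∀ s Y → suc (s ℕ.+ card Y) ≡ d → ∑⊇ Y ≡ 0ℚ
    ∑⊇-vanishes-below zero    Y 1+|Y|≡d = isHarmonic⇒∑⊇-vanishes harm Y 1+|Y|≡d
    ∑⊇-vanishes-below (suc s) Y eq = *-cancelˡ-≢0 (fromℕ (d ∸ card Y)) d-|Y|≢0 (begin
      fromℕ (d ∸ card Y) * ∑⊇ Y ≡⟨ *-comm _ (∑⊇ Y) ⟩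
      ∑⊇ Y * fromℕ (d ∸ card Y) ≡⟨ ∑⊇-step Y ⟨
      ∑ n (λ W → [ (Y ⊆ᵇ W) ∧ (card W ≡ᵇ suc (card Y)) ]ℚ (∑⊇ W)) ≡⟨ ∑-vanish n next-layer ⟩
      0ℚ                        ≡⟨ *-zeroʳ (fromℕ (d ∸ card Y)) ⟨
      fromℕ (d ∸ card Y) * 0ℚ   ∎)
      where
      open ≡-Reasoning
      d-|Y|≢0 : fromℕ (d ∸ card Y) ≢ 0ℚ
      d-|Y|≢0 rewrite sym eq | ℕP.m+n∸n≡m (suc (suc s)) (card Y) = positive⇒≢0 (fromℕ-suc-pos (suc s))
      next-layer : ∀ W → [ (Y ⊆ᵇ W) ∧ (card W ≡ᵇ suc (card Y)) ]ℚ (∑⊇ W) ≡ 0ℚ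
      next-layer W with card W ≡ᵇ suc (card Y) in |W|≡ᵇ1+|Y|
      ... | false = []-∧-false (Y ⊆ᵇ W) _
      ... | true  = trans (cong [ (Y ⊆ᵇ W) ∧ true ]ℚ (∑⊇-vanishes-below s W 1+s+|W|≡d)) ([]-0 _)
        where
        1+s+|W|≡d : suc (s ℕ.+ card W) ≡ d
        1+s+|W|≡d = trans (cong (λ m → suc (s ℕ.+ m)) (≡ᵇ⇒≡ (card W) (suc (card Y)) |W|≡ᵇ1+|Y|))
                          (trans (cong suc (ℕP.+-suc s (card Y))) eq)

    ∑⊇-signed : ∀ K Y → [ Y ⊆ᵇ K ]ℚ ((- 1ℚ) ^ card Y * ∑⊇ Y) ≡ [ (card Y ≡ᵇ d) ∧ (Y ⊆ᵇ K) ]ℚ ((- 1ℚ) ^ d * f Y)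
    ∑⊇-signed K Y with ℕP.<-cmp (card Y) d
    ... | tri< |Y|<d _ _
      rewrite ≢⇒≡ᵇ-false (ℕP.<⇒≢ |Y|<d)
            | ∑⊇-vanishes-below (d ∸ suc (card Y)) Y (trans (sym (ℕP.+-suc _ (card Y))) (ℕP.m∸n+n≡m |Y|<d))
      = trans (cong [ Y ⊆ᵇ K ]ℚ (*-zeroʳ ((- 1ℚ) ^ card Y))) ([]-0 (Y ⊆ᵇ K))
    ... | tri≈ _ refl _ rewrite ≡ᵇ-refl (card Y) =
      cong (λ s → [ Y ⊆ᵇ K ]ℚ ((- 1ℚ) ^ card Y * s)) (∑-superset-delta n Y f)
    ... | tri> _ _ |Y|>d rewrite ≢⇒≡ᵇ-false (ℕP.>⇒≢ |Y|>d) =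
      trans (cong (λ s → [ Y ⊆ᵇ K ]ℚ ((- 1ℚ) ^ card Y * s)) (∑-vanish n too-small))
            (trans (cong [ Y ⊆ᵇ K ]ℚ (*-zeroʳ ((- 1ℚ) ^ card Y))) ([]-0 (Y ⊆ᵇ K)))
      where
      too-small : ∀ Z → [ (card Z ≡ᵇ d) ∧ (Y ⊆ᵇ Z) ]ℚ (f Z) ≡ 0ℚ
      too-small Z with Y ⊆ᵇ Z in Y⊆Z
      ... | false = []-∧-false (card Z ≡ᵇ d) (f Z)
      ... | true  rewrite ≢⇒≡ᵇ-false (ℕP.>⇒≢ (ℕP.<-≤-trans |Y|>d (⊆ᵇ⇒card≤ Y Z Y⊆Z))) = refl

    f̃-∁ : ∀ K → f̃ K ≡ (- 1ℚ) ^ d * f̃ (∁ K)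
    f̃-∁ K = begin
      f̃ K
        ≡⟨ ∑-cong n (λ Z → trans ([]-∧ (e Z) (Z ⊆ᵇ K) (f Z)) (cong [ e Z ]ℚ (inclusion-exclusion n Z K (f Z)))) ⟩
      ∑ n (λ Z → [ e Z ]ℚ (∑ n (λ Y → [ (Y ⊆ᵇ Z) ∧ (Y ⊆ᵇ ∁ K) ]ℚ ((- 1ℚ) ^ card Y * f Z))))
        ≡⟨ ∑-cong n (λ Z → []-∑ n (e Z) _) ⟩
      ∑ n (λ Z → ∑ n (λ Y → [ e Z ]ℚ ([ (Y ⊆ᵇ Z) ∧ (Y ⊆ᵇ ∁ K) ]ℚ ((- 1ℚ) ^ card Y * f Z))))
        ≡⟨ ∑-swap n n _ ⟩
      ∑ n (λ Y → ∑ n (λ Z → [ e Z ]ℚ ([ (Y ⊆ᵇ Z) ∧ (Y ⊆ᵇ ∁ K) ]ℚ ((- 1ℚ) ^ card Y * f Z))))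
        ≡⟨ ∑-cong n (λ Y → ∑-cong n (λ Z → regroup (e Z) (Y ⊆ᵇ Z) (Y ⊆ᵇ ∁ K) ((- 1ℚ) ^ card Y) (f Z))) ⟩
      ∑ n (λ Y → ∑ n (λ Z → [ Y ⊆ᵇ ∁ K ]ℚ ((- 1ℚ) ^ card Y * [ e Z ∧ (Y ⊆ᵇ Z) ]ℚ (f Z))))
        ≡⟨ ∑-cong n (λ Y → trans (sym ([]-∑ n (Y ⊆ᵇ ∁ K) _)) (cong [ Y ⊆ᵇ ∁ K ]ℚ (∑-*ˡ n ((- 1ℚ) ^ card Y) (λ Z → [ e Z ∧ (Y ⊆ᵇ Z) ]ℚ (f Z))))) ⟩
      ∑ n (λ Y → [ Y ⊆ᵇ ∁ K ]ℚ ((- 1ℚ) ^ card Y * ∑⊇ Y))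
        ≡⟨ ∑-cong n (∑⊇-signed (∁ K)) ⟩
      ∑ n (λ Y → [ e Y ∧ (Y ⊆ᵇ ∁ K) ]ℚ ((- 1ℚ) ^ d * f Y))
        ≡⟨ ∑-cong n (λ Y → []-*ˡ (e Y ∧ (Y ⊆ᵇ ∁ K)) ((- 1ℚ) ^ d) (f Y)) ⟩
      ∑ n (λ Y → (- 1ℚ) ^ d * [ e Y ∧ (Y ⊆ᵇ ∁ K) ]ℚ (f Y))
        ≡⟨ ∑-*ˡ n ((- 1ℚ) ^ d) _ ⟩
      (- 1ℚ) ^ d * f̃ (∁ K) ∎
      where
      open ≡-Reasoning
      e : Vec Bool n → Bool
      e Z = card Z ≡ᵇ d
      regroup : ∀ e y b s q → [ e ]ℚ ([ y ∧ b ]ℚ (s * q)) ≡ [ b ]ℚ (s * [ e ∧ y ]ℚ q)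
      regroup false y     false s q = refl
      regroup false y     true  s q = sym (*-zeroʳ s)
      regroup true  false false s q = refl
      regroup true  false true  s q = sym (*-zeroʳ s)
      regroup true  true  b     s q = refl

-- Characters of 𝔽₂ⁿ and the double counting for a generator matrix

infix 8 _·_
_·_ : ∀ {n} → Vec Bool n → Vec Bool n → Bool
u · c = parity (zipWith _∧_ u c)

disjointᵇ : ∀ {n} → Vec Bool n → Vec Bool n → Bool
disjointᵇ u J = isZeroᵇ (zipWith _∧_ u J)

sign : Bool → ℚ
sign b = if b then - 1ℚ else 1ℚ

sign-not : ∀ b → sign (not b) ≡ - 1ℚ * sign b
sign-not false = refl
sign-not true  = refl

[]-+-[] : ∀ b q → [ b ]ℚ q + [ b ]ℚ q ≡ [ b ]ℚ (2ℚ * q)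
[]-+-[] false q = refl
[]-+-[] true  q = q+q≡2q q

∑-⊆-sign : ∀ n (v J : Vec Bool n) →
  ∑ n (λ c → [ c ⊆ᵇ J ]ℚ (sign (v · c))) ≡ [ disjointᵇ v J ]ℚ (2ℚ ^ card J)
∑-⊆-sign zero    []          []          = ∑-[] _
∑-⊆-sign (suc n) (false ∷ v) (false ∷ J) = trans (∑-∷ n _) (trans (cong₂ _+_ (∑-⊆-sign n v J) (∑-0 n)) (+-identityʳ _))
∑-⊆-sign (suc n) (false ∷ v) (true ∷ J)  = trans (∑-∷ n _)
  (trans (cong₂ _+_ (∑-⊆-sign n v J) (∑-⊆-sign n v J)) ([]-+-[] (disjointᵇ v J) (2ℚ ^ card J)))
∑-⊆-sign (suc n) (true ∷ v)  (false ∷ J) = trans (∑-∷ n _) (trans (cong₂ _+_ (∑-⊆-sign n v J) (∑-0 n)) (+-identityʳ _))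
∑-⊆-sign (suc n) (true ∷ v)  (true ∷ J)  = trans (∑-∷ n _)
  (trans (cong (_+_ (∑ n term)) (∑-cong n flip-sign)) (∑-+-∑-neg n term))
  where
  term : Vec Bool n → ℚ
  term c = [ c ⊆ᵇ J ]ℚ (sign (v · c))
  flip-sign : ∀ c → [ c ⊆ᵇ J ]ℚ (sign (not (v · c))) ≡ - 1ℚ * term c
  flip-sign c = trans (cong [ c ⊆ᵇ J ]ℚ (sign-not (v · c))) ([]-*ˡ (c ⊆ᵇ J) (- 1ℚ) (sign (v · c)))

∑-sign : ∀ k (w : Vec Bool k) → ∑ k (λ m → sign (m · w)) ≡ [ isZeroᵇ w ]ℚ (2ℚ ^ k)
∑-sign zero    []          = ∑-[] _
∑-sign (suc k) (false ∷ w) = trans (∑-∷ k _)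
  (trans (cong₂ _+_ (∑-sign k w) (∑-sign k w)) ([]-+-[] (isZeroᵇ w) (2ℚ ^ k)))
∑-sign (suc k) (true ∷ w)  = trans (∑-∷ k _)
  (trans (cong (_+_ (∑ k (λ m → sign (m · w)))) (∑-cong k (λ m → sign-not (m · w))))
         (∑-+-∑-neg k (λ m → sign (m · w))))

·-distribˡ-xor : ∀ {n} (r s c : Vec Bool n) → zipWith _xor_ r s · c ≡ (r · c) xor (s · c)
·-distribˡ-xor []       []       []       = refl
·-distribˡ-xor (a ∷ r) (b ∷ s) (x ∷ c) = begin
  ((a xor b) ∧ x) xor (zipWith _xor_ r s · c)     ≡⟨ cong₂ _xor_ (𝔹.∧-distribʳ-xor x a b) (·-distribˡ-xor r s c) ⟩
  ((a ∧ x) xor (b ∧ x)) xor ((r · c) xor (s · c)) ≡⟨ interchange (a ∧ x) (b ∧ x) (r · c) (s · c) ⟩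
  ((a ∧ x) xor (r · c)) xor ((b ∧ x) xor (s · c)) ∎
  where open ≡-Reasoning

replicate-false-· : ∀ {n} (c : Vec Bool n) → replicate n false · c ≡ false
replicate-false-· []      = refl
replicate-false-· (_ ∷ c) = replicate-false-· c

encode-· : ∀ {k n} (G : Vec (Vec Bool n) k) (m : Vec Bool k) (c : Vec Bool n) →
  encode G m · c ≡ m · colCombo G c
encode-· []      []          c = replicate-false-· c
encode-· (r ∷ G) (false ∷ m) c = encode-· G m c
encode-· (r ∷ G) (true ∷ m)  c = trans (·-distribˡ-xor r (encode G m) c) (cong (r · c xor_) (encode-· G m c))

module Code {k n : ℕ} (G : Vec (Vec Bool n) k) where

  #vanishingOn : Vec Bool n → ℚ
  #vanishingOn J = ∑ k (λ m → [ disjointᵇ (encode G m) J ]ℚ 1ℚ)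

  #dependencies : Vec Bool n → ℚ
  #dependencies J = ∑ n (λ c → [ (c ⊆ᵇ J) ∧ isZeroᵇ (colCombo G c) ]ℚ 1ℚ)

  -- Sum the character sign ((mG)·c) over pairs (m, c ⊆ J) in both orders.
  #vanishingOn-duality : ∀ J → 2ℚ ^ card J * #vanishingOn J ≡ #dependencies J * 2ℚ ^ k
  #vanishingOn-duality J = begin
    2ℚ ^ card J * #vanishingOn J
      ≡⟨ ∑-*ˡ k (2ℚ ^ card J) _ ⟨
    ∑ k (λ m → 2ℚ ^ card J * [ vanishes m ]ℚ 1ℚ)
      ≡⟨ ∑-cong k (λ m → scale (vanishes m)) ⟩
    ∑ k (λ m → [ vanishes m ]ℚ (2ℚ ^ card J))
      ≡⟨ ∑-cong k (λ m → ∑-⊆-sign n (encode G m) J) ⟨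
    ∑ k (λ m → ∑ n (λ c → [ c ⊆ᵇ J ]ℚ (sign (encode G m · c))))
      ≡⟨ ∑-swap k n _ ⟩
    ∑ n (λ c → ∑ k (λ m → [ c ⊆ᵇ J ]ℚ (sign (encode G m · c))))
      ≡⟨ ∑-cong n (λ c → ∑-cong k (λ m → cong (λ b → [ c ⊆ᵇ J ]ℚ (sign b)) (encode-· G m c))) ⟩
    ∑ n (λ c → ∑ k (λ m → [ c ⊆ᵇ J ]ℚ (sign (m · colCombo G c))))
      ≡⟨ ∑-cong n (λ c → trans (sym ([]-∑ k (c ⊆ᵇ J) _)) (cong [ c ⊆ᵇ J ]ℚ (∑-sign k (colCombo G c)))) ⟩
    ∑ n (λ c → [ c ⊆ᵇ J ]ℚ ([ isZeroᵇ (colCombo G c) ]ℚ (2ℚ ^ k)))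
      ≡⟨ ∑-cong n (λ c → factor (c ⊆ᵇ J) (isZeroᵇ (colCombo G c))) ⟩
    ∑ n (λ c → [ (c ⊆ᵇ J) ∧ isZeroᵇ (colCombo G c) ]ℚ 1ℚ * 2ℚ ^ k)
      ≡⟨ ∑-*ʳ n (2ℚ ^ k) _ ⟩
    #dependencies J * 2ℚ ^ k ∎
    where
    open ≡-Reasoning
    vanishes : Vec Bool k → Bool
    vanishes m = disjointᵇ (encode G m) J
    scale : ∀ b → 2ℚ ^ card J * [ b ]ℚ 1ℚ ≡ [ b ]ℚ (2ℚ ^ card J)
    scale false = *-zeroʳ (2ℚ ^ card J)
    scale true  = *-identityʳ (2ℚ ^ card J)
    factor : ∀ a b → [ a ]ℚ ([ b ]ℚ (2ℚ ^ k)) ≡ [ a ∧ b ]ℚ 1ℚ * 2ℚ ^ k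
    factor false b     = sym (*-zeroˡ (2ℚ ^ k))
    factor true  false = sym (*-zeroˡ (2ℚ ^ k))
    factor true  true  = sym (*-identityˡ (2ℚ ^ k))

-- Finite maxima and the rank function of the column matroid

maxOver : {A : Set} → List A → (A → ℕ) → ℕ
maxOver l h = foldr (λ x m → h x ⊔ m) 0 l

maxℕ-filter : ∀ {A : Set} (g : A → ℕ) (p : A → Bool) (l : List A) →
  maxℕ (map g (filter p l)) ≡ maxOver l (λ x → if p x then g x else 0)
maxℕ-filter g p []      = refl
maxℕ-filter g p (x ∷ l) with p x
... | true  = cong (g x ⊔_) (maxℕ-filter g p l)
... | false = maxℕ-filter g p l

maxOver-allVecs-suc : ∀ n (h : Vec Bool (suc n) → ℕ) →
  maxOver (allVecs (suc n)) h ≡ maxOver (allVecs n) (λ v → h (false ∷ v) ⊔ h (true ∷ v))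
maxOver-allVecs-suc n h = go (allVecs n)
  where
  go : ∀ l → maxOver (concatMap (λ v → (false ∷ v) ∷ (true ∷ v) ∷ []) l) h
           ≡ maxOver l (λ v → h (false ∷ v) ⊔ h (true ∷ v))
  go []      = refl
  go (v ∷ l) = trans (cong (λ m → h (false ∷ v) ⊔ (h (true ∷ v) ⊔ m)) (go l))
                     (sym (ℕP.⊔-assoc (h (false ∷ v)) (h (true ∷ v)) _))

≤-maxOver : ∀ n (h : Vec Bool n → ℕ) v → h v ℕ.≤ maxOver (allVecs n) h
≤-maxOver zero    h []      = ℕP.m≤m⊔n (h []) 0
≤-maxOver (suc n) h (b ∷ v) rewrite maxOver-allVecs-suc n h =
  ℕP.≤-trans (≤-⊔ b) (≤-maxOver n (λ v → h (false ∷ v) ⊔ h (true ∷ v)) v)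
  where
  ≤-⊔ : ∀ b → h (b ∷ v) ℕ.≤ h (false ∷ v) ⊔ h (true ∷ v)
  ≤-⊔ false = ℕP.m≤m⊔n _ _
  ≤-⊔ true  = ℕP.m≤n⊔m _ _

maxOver-attained : ∀ n (h : Vec Bool n → ℕ) → ∃ λ v → maxOver (allVecs n) h ≡ h v
maxOver-attained zero    h = [] , ℕP.⊔-identityʳ (h [])
maxOver-attained (suc n) h with maxOver-attained n (λ v → h (false ∷ v) ⊔ h (true ∷ v))
... | v , max≡ with ℕP.⊔-sel (h (false ∷ v)) (h (true ∷ v))
... | inj₁ ⊔≡f = (false ∷ v) , trans (maxOver-allVecs-suc n h) (trans max≡ ⊔≡f)
... | inj₂ ⊔≡t = (true ∷ v)  , trans (maxOver-allVecs-suc n h) (trans max≡ ⊔≡t)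

∧-true₁ : ∀ a b → a ∧ b ≡ true → a ≡ true
∧-true₁ true b _ = refl

∧-true₂ : ∀ a b → a ∧ b ≡ true → b ≡ true
∧-true₂ true b b≡true = b≡true

allL-allVecs-suc : ∀ n (p : Vec Bool (suc n) → Bool) →
  allL p (allVecs (suc n)) ≡ allL (λ v → p (false ∷ v) ∧ p (true ∷ v)) (allVecs n)
allL-allVecs-suc n p = go (allVecs n)
  where
  go : ∀ l → allL p (concatMap (λ v → (false ∷ v) ∷ (true ∷ v) ∷ []) l)
           ≡ allL (λ v → p (false ∷ v) ∧ p (true ∷ v)) l
  go []      = refl
  go (v ∷ l) = trans (cong (λ b → p (false ∷ v) ∧ (p (true ∷ v) ∧ b)) (go l))
                     (sym (𝔹.∧-assoc (p (false ∷ v)) (p (true ∷ v)) _))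

allL-sound : ∀ n (p : Vec Bool n → Bool) → allL p (allVecs n) ≡ true → ∀ v → p v ≡ true
allL-sound zero    p all []          = ∧-true₁ (p []) true all
allL-sound (suc n) p all (false ∷ v) = ∧-true₁ _ _ (allL-sound n _ (trans (sym (allL-allVecs-suc n p)) all) v)
allL-sound (suc n) p all (true ∷ v)  = ∧-true₂ _ _ (allL-sound n _ (trans (sym (allL-allVecs-suc n p)) all) v)

allL-complete : ∀ n (p : Vec Bool n → Bool) → (∀ v → p v ≡ true) → allL p (allVecs n) ≡ true
allL-complete zero    p p≡true rewrite p≡true [] = refl
allL-complete (suc n) p p≡true = trans (allL-allVecs-suc n p)
  (allL-complete n _ (λ v → cong₂ _∧_ (p≡true (false ∷ v)) (p≡true (true ∷ v))))

allL-counterexample : ∀ n (p : Vec Bool n → Bool) → allL p (allVecs n) ≡ false → ∃ λ v → p v ≡ false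
allL-counterexample zero    p all with p [] in p[]
... | false = [] , p[]
allL-counterexample (suc n) p all
  with allL-counterexample n (λ v → p (false ∷ v) ∧ p (true ∷ v)) (trans (sym (allL-allVecs-suc n p)) all)
... | v , pv≡false with p (false ∷ v) in p0v
... | false = (false ∷ v) , p0v
... | true  = (true ∷ v)  , pv≡false

⊆ᵇ-lookup : ∀ {n} (I J : Vec Bool n) j → I ⊆ᵇ J ≡ true → lookup I j ≡ true → lookup J j ≡ true
⊆ᵇ-lookup (true ∷ I)  (true ∷ J) zero    _   _    = refl
⊆ᵇ-lookup (false ∷ I) (_ ∷ J)    (suc j) I⊆J I[j] = ⊆ᵇ-lookup I J j I⊆J I[j]
⊆ᵇ-lookup (true ∷ I)  (true ∷ J) (suc j) I⊆J I[j] = ⊆ᵇ-lookup I J j I⊆J I[j]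

disjointᵇ-intro : ∀ {n} (v J : Vec Bool n) → (∀ j → lookup J j ≡ true → lookup v j ≡ false) → disjointᵇ v J ≡ true
disjointᵇ-intro []       []          _    = refl
disjointᵇ-intro (a ∷ v) (false ∷ J) v⊥J rewrite 𝔹.∧-zeroʳ a = disjointᵇ-intro v J (v⊥J ∘ suc)
disjointᵇ-intro (a ∷ v) (true ∷ J)  v⊥J rewrite v⊥J zero refl = disjointᵇ-intro v J (v⊥J ∘ suc)

disjointᵇ-lookup : ∀ {n} (v I : Vec Bool n) j → disjointᵇ v I ≡ true → lookup I j ≡ true → lookup v j ≡ false
disjointᵇ-lookup (false ∷ v) (true ∷ I)  zero    _   _    = refl
disjointᵇ-lookup (true ∷ v)  (true ∷ I)  zero    ()  _
disjointᵇ-lookup (true ∷ v)  (false ∷ I) zero    _   ()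
disjointᵇ-lookup (_ ∷ v)     (_ ∷ I)     (suc j) v⊥I I[j] = disjointᵇ-lookup v I j (∧-true₂ _ _ v⊥I) I[j]

disjointᵇ-⊆ : ∀ {n} (v I J : Vec Bool n) → I ⊆ᵇ J ≡ true → disjointᵇ v J ≡ true → disjointᵇ v I ≡ true
disjointᵇ-⊆ v I J I⊆J v⊥J =
  disjointᵇ-intro v I (λ j I[j] → disjointᵇ-lookup v J j v⊥J (⊆ᵇ-lookup I J j I⊆J I[j]))

insert : ∀ {n} → Vec Bool n → Fin n → Vec Bool n
insert (_ ∷ v) zero    = true ∷ v
insert (x ∷ v) (suc j) = x ∷ insert v j

card-insert : ∀ {n} (I : Vec Bool n) j → lookup I j ≡ false → card (insert I j) ≡ suc (card I)
card-insert (false ∷ I) zero    _    = refl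
card-insert (false ∷ I) (suc j) I[j] = card-insert I j I[j]
card-insert (true ∷ I)  (suc j) I[j] = cong suc (card-insert I j I[j])

insert-⊆ᵇ : ∀ {n} (I J : Vec Bool n) j → I ⊆ᵇ J ≡ true → lookup J j ≡ true → insert I j ⊆ᵇ J ≡ true
insert-⊆ᵇ (_ ∷ I)     (true ∷ J) zero    I⊆J _    = ∧-true₂ _ _ I⊆J
insert-⊆ᵇ (false ∷ I) (_ ∷ J)    (suc j) I⊆J J[j] = insert-⊆ᵇ I J j I⊆J J[j]
insert-⊆ᵇ (true ∷ I)  (true ∷ J) (suc j) I⊆J J[j] = insert-⊆ᵇ I J j I⊆J J[j]

⊆ᵇ-insert⇒⊆ᵇ : ∀ {n} (c I : Vec Bool n) j → c ⊆ᵇ insert I j ≡ true → lookup c j ≡ false → c ⊆ᵇ I ≡ true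
⊆ᵇ-insert⇒⊆ᵇ (false ∷ c) (false ∷ I) zero    c⊆ _    = c⊆
⊆ᵇ-insert⇒⊆ᵇ (false ∷ c) (true ∷ I)  zero    c⊆ _    = c⊆
⊆ᵇ-insert⇒⊆ᵇ (false ∷ c) (false ∷ I) (suc j) c⊆ c[j] = ⊆ᵇ-insert⇒⊆ᵇ c I j c⊆ c[j]
⊆ᵇ-insert⇒⊆ᵇ (false ∷ c) (true ∷ I)  (suc j) c⊆ c[j] = ⊆ᵇ-insert⇒⊆ᵇ c I j c⊆ c[j]
⊆ᵇ-insert⇒⊆ᵇ (true ∷ c)  (true ∷ I)  (suc j) c⊆ c[j] = ⊆ᵇ-insert⇒⊆ᵇ c I j c⊆ c[j]

disjoint-⊆⇒·≡false : ∀ {n} (v c I : Vec Bool n) → disjointᵇ v I ≡ true → c ⊆ᵇ I ≡ true → v · c ≡ false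
disjoint-⊆⇒·≡false []       []          []      _   _  = refl
disjoint-⊆⇒·≡false (false ∷ v) (false ∷ c) (_ ∷ I)    v⊥I c⊆I = disjoint-⊆⇒·≡false v c I (∧-true₂ _ _ v⊥I) c⊆I
disjoint-⊆⇒·≡false (true ∷ v)  (false ∷ c) (_ ∷ I)    v⊥I c⊆I = disjoint-⊆⇒·≡false v c I (∧-true₂ _ _ v⊥I) c⊆I
disjoint-⊆⇒·≡false (false ∷ v) (true ∷ c)  (true ∷ I) v⊥I c⊆I = disjoint-⊆⇒·≡false v c I v⊥I c⊆I
disjoint-⊆⇒·≡false (true ∷ v)  (true ∷ c)  (true ∷ I)  ()  _
disjoint-⊆⇒·≡false (true ∷ v)  (true ∷ c)  (false ∷ I) _   ()

·-insert : ∀ {n} (v c I : Vec Bool n) j → disjointᵇ v I ≡ true → c ⊆ᵇ insert I j ≡ true →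
  lookup c j ≡ true → v · c ≡ lookup v j
·-insert (a ∷ v) (true ∷ c) (_ ∷ I) zero v⊥I c⊆ _ rewrite 𝔹.∧-identityʳ a =
  trans (cong (a xor_) (disjoint-⊆⇒·≡false v c I (∧-true₂ _ _ v⊥I) c⊆)) (𝔹.xor-identityʳ a)
·-insert (a ∷ v) (x ∷ c) (y ∷ I) (suc j) v⊥I c⊆ c[j] =
  trans (cong (_xor (v · c)) (head-vanishes a x y (∧-true₁ _ _ v⊥I) (∧-true₁ _ _ c⊆)))
        (·-insert v c I j (∧-true₂ _ _ v⊥I) (∧-true₂ _ _ c⊆) c[j])
  where
  head-vanishes : ∀ a x y → not (a ∧ y) ≡ true → not x ∨ y ≡ true → a ∧ x ≡ false
  head-vanishes false x     y     _ _  = refl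
  head-vanishes true  false y     _ _  = refl
  head-vanishes true  true  true  () _

≡true-ext : ∀ {a b} → (a ≡ true → b ≡ true) → (b ≡ true → a ≡ true) → a ≡ b
≡true-ext {false} {false} _   _   = refl
≡true-ext {false} {true}  _   b⇒a = b⇒a refl
≡true-ext {true}  {b}     a⇒b _   = sym (a⇒b refl)

isZeroᵇ⇒⊆ᵇ : ∀ {n} (c I : Vec Bool n) → isZeroᵇ c ≡ true → c ⊆ᵇ I ≡ true
isZeroᵇ⇒⊆ᵇ []          []      _   = refl
isZeroᵇ⇒⊆ᵇ (false ∷ c) (_ ∷ I) c≡0 = isZeroᵇ⇒⊆ᵇ c I c≡0

isZeroᵇ⇒·≡false : ∀ {n} (r c : Vec Bool n) → isZeroᵇ c ≡ true → r · c ≡ false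
isZeroᵇ⇒·≡false []      []          _   = refl
isZeroᵇ⇒·≡false (a ∷ r) (false ∷ c) c≡0 rewrite 𝔹.∧-zeroʳ a = isZeroᵇ⇒·≡false r c c≡0

isZeroᵇ-colCombo : ∀ {k n} (G : Vec (Vec Bool n) k) c → isZeroᵇ c ≡ true → isZeroᵇ (colCombo G c) ≡ true
isZeroᵇ-colCombo []      c c≡0 = refl
isZeroᵇ-colCombo (r ∷ G) c c≡0 rewrite isZeroᵇ⇒·≡false r c c≡0 = isZeroᵇ-colCombo G c c≡0

isZeroᵇ-replicate : ∀ n → isZeroᵇ (replicate n false) ≡ true
isZeroᵇ-replicate zero    = refl
isZeroᵇ-replicate (suc n) = isZeroᵇ-replicate n

isZeroᵇ⇒≡replicate : ∀ {n} (c : Vec Bool n) → isZeroᵇ c ≡ true → c ≡ replicate n false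
isZeroᵇ⇒≡replicate []          _   = refl
isZeroᵇ⇒≡replicate (false ∷ c) c≡0 = cong (false ∷_) (isZeroᵇ⇒≡replicate c c≡0)

disjointᵇ-full : ∀ {n} (v : Vec Bool n) → disjointᵇ v (replicate n true) ≡ isZeroᵇ v
disjointᵇ-full []      = refl
disjointᵇ-full (a ∷ v) rewrite 𝔹.∧-identityʳ a = cong (not a ∧_) (disjointᵇ-full v)

⊆ᵇ-full : ∀ {n} (v : Vec Bool n) → v ⊆ᵇ replicate n true ≡ true
⊆ᵇ-full []          = refl
⊆ᵇ-full (false ∷ v) = ⊆ᵇ-full v
⊆ᵇ-full (true ∷ v)  = ⊆ᵇ-full v

⊆ᵇ-empty⇒isZeroᵇ : ∀ {n} (c : Vec Bool n) → c ⊆ᵇ replicate n false ≡ true → isZeroᵇ c ≡ true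
⊆ᵇ-empty⇒isZeroᵇ []          _   = refl
⊆ᵇ-empty⇒isZeroᵇ (false ∷ c) c⊆∅ = ⊆ᵇ-empty⇒isZeroᵇ c c⊆∅

card-replicate-false : ∀ n → card (replicate n false) ≡ 0
card-replicate-false zero    = refl
card-replicate-false (suc n) = card-replicate-false n

encode-replicate-false : ∀ {k n} (G : Vec (Vec Bool n) k) → encode G (replicate k false) ≡ replicate n false
encode-replicate-false []      = refl
encode-replicate-false (r ∷ G) = encode-replicate-false G

module Rank {k n : ℕ} (G : Vec (Vec Bool n) k) where
  open Code G

  E : Vec Bool n
  E = replicate n true

  independentIn : Vec Bool n → Vec Bool n → Bool
  independentIn J I = (I ⊆ᵇ J) ∧ independentᵇ G I

  card≤rank : ∀ J I → independentIn J I ≡ true → card I ℕ.≤ rank G J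
  card≤rank J I indep = subst (card I ℕ.≤_) (sym (maxℕ-filter card (independentIn J) (allVecs n)))
    (subst (ℕ._≤ maxOver (allVecs n) score) score-I (≤-maxOver n score I))
    where
    score : Vec Bool n → ℕ
    score I = if independentIn J I then card I else 0
    score-I : score I ≡ card I
    score-I rewrite indep = refl

  dependency : Vec Bool n → Vec Bool n → Bool
  dependency I c = not (c ⊆ᵇ I) ∨ not (isZeroᵇ (colCombo G c)) ∨ isZeroᵇ c

  independentᵇ-sound : ∀ I → independentᵇ G I ≡ true →
    ∀ c → c ⊆ᵇ I ≡ true → isZeroᵇ (colCombo G c) ≡ true → isZeroᵇ c ≡ true
  independentᵇ-sound I indep c c⊆I Gc≡0 with allL-sound n (dependency I) indep c
  ... | no-dependency rewrite c⊆I | Gc≡0 = no-dependency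

  dependent⇒dependency : ∀ I → independentᵇ G I ≡ false →
    ∃ λ c → c ⊆ᵇ I ≡ true × isZeroᵇ (colCombo G c) ≡ true × isZeroᵇ c ≡ false
  dependent⇒dependency I dep with allL-counterexample n (dependency I) dep
  ... | c , counterexample = c , unpack (c ⊆ᵇ I) (isZeroᵇ (colCombo G c)) (isZeroᵇ c) counterexample
    where
    unpack : ∀ a b z → not a ∨ not b ∨ z ≡ false → a ≡ true × b ≡ true × z ≡ false
    unpack true true false _ = refl , refl , refl

  independentᵇ-∅ : independentᵇ G (replicate n false) ≡ true
  independentᵇ-∅ = allL-complete n (dependency (replicate n false)) no-dependency
    where
    no-dependency : ∀ c → dependency (replicate n false) c ≡ true
    no-dependency c with c ⊆ᵇ replicate n false in c⊆∅
    ... | false = refl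
    ... | true  rewrite ⊆ᵇ-empty⇒isZeroᵇ c c⊆∅ = 𝔹.∨-zeroʳ _

  basis : ∀ J → ∃ λ I → independentIn J I ≡ true × card I ≡ rank G J
  basis J with maxOver-attained n (λ I → if independentIn J I then card I else 0)
  ... | I , max≡ with independentIn J I in indep
  ... | true  = I , indep , sym (trans (maxℕ-filter card (independentIn J) (allVecs n)) max≡)
  ... | false = replicate n false
              , cong₂ _∧_ (isZeroᵇ⇒⊆ᵇ (replicate n false) J (isZeroᵇ-replicate n)) independentᵇ-∅
              , trans (card-replicate-false n) (sym (trans (maxℕ-filter card (independentIn J) (allVecs n)) max≡))

  -- If mG were nonzero at some j ∈ J ∖ I, either I ∪ {j} is independent, contradicting maximality,
  -- or a dependency c ⊆ I ∪ {j} through j gives (mG)ⱼ = mG·c = m·Gc = 0.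
  basis-spans : ∀ J I → independentIn J I ≡ true → card I ≡ rank G J → ∀ m →
    disjointᵇ (encode G m) I ≡ true → disjointᵇ (encode G m) J ≡ true
  basis-spans J I I-indep |I|≡ρJ m mG⊥I = disjointᵇ-intro (encode G m) J vanishes-at
    where
    vanishes-at : ∀ j → lookup J j ≡ true → lookup (encode G m) j ≡ false
    vanishes-at j J[j] with lookup I j in I[j]
    ... | true  = disjointᵇ-lookup (encode G m) I j mG⊥I I[j]
    ... | false with independentᵇ G (insert I j) in indep
    ...   | true  = ⊥-elim (ℕP.<-irrefl refl (subst (ℕ._≤ card I) (card-insert I j I[j])
                      (subst (card (insert I j) ℕ.≤_) (sym |I|≡ρJ)
                        (card≤rank J (insert I j) (cong₂ _∧_ (insert-⊆ᵇ I J j (∧-true₁ _ _ I-indep) J[j]) indep)))))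
    ...   | false with dependent⇒dependency (insert I j) indep
    ...     | c , c⊆ , Gc≡0 , c≢0 with lookup c j in c[j]
    ...       | false = ⊥-elim (𝔹.not-¬ (independentᵇ-sound I (∧-true₂ _ _ I-indep) c (⊆ᵇ-insert⇒⊆ᵇ c I j c⊆ c[j]) Gc≡0) c≢0)
    ...       | true  = trans (sym (·-insert (encode G m) c I j mG⊥I c⊆ c[j]))
                              (trans (encode-· G m c) (isZeroᵇ⇒·≡false m (colCombo G c) Gc≡0))

  #vanishingOn-basis : ∀ J I → independentIn J I ≡ true → card I ≡ rank G J → #vanishingOn J ≡ #vanishingOn I
  #vanishingOn-basis J I I-indep |I|≡ρJ = ∑-cong k (λ m → cong (λ b → [ b ]ℚ 1ℚ)
    (≡true-ext (disjointᵇ-⊆ (encode G m) I J (∧-true₁ _ _ I-indep)) (basis-spans J I I-indep |I|≡ρJ m)))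

  #dependencies-independent : ∀ I → independentᵇ G I ≡ true → #dependencies I ≡ 1ℚ
  #dependencies-independent I indep = trans (∑-cong n only-trivial) (∑-isZero-delta n 1ℚ)
    where
    only-trivial : ∀ c → [ (c ⊆ᵇ I) ∧ isZeroᵇ (colCombo G c) ]ℚ 1ℚ ≡ [ isZeroᵇ c ]ℚ 1ℚ
    only-trivial c with isZeroᵇ c in c≡0
    ... | true  rewrite isZeroᵇ⇒⊆ᵇ c I c≡0 | isZeroᵇ-colCombo G c c≡0 = refl
    ... | false with c ⊆ᵇ I in c⊆I | isZeroᵇ (colCombo G c) in Gc≡0
    ...   | true  | true  = ⊥-elim (𝔹.not-¬ (independentᵇ-sound I indep c c⊆I Gc≡0) c≡0)
    ...   | true  | false = refl
    ...   | false | _     = refl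

  2^rank*#vanishingOn : ∀ J → 2ℚ ^ rank G J * #vanishingOn J ≡ 2ℚ ^ k
  2^rank*#vanishingOn J with basis J
  ... | I , I-indep , |I|≡ρJ = begin
    2ℚ ^ rank G J * #vanishingOn J ≡⟨ cong₂ (λ r N → 2ℚ ^ r * N) (sym |I|≡ρJ) (#vanishingOn-basis J I I-indep |I|≡ρJ) ⟩
    2ℚ ^ card I * #vanishingOn I   ≡⟨ #vanishingOn-duality I ⟩
    #dependencies I * 2ℚ ^ k       ≡⟨ cong (_* 2ℚ ^ k) (#dependencies-independent I (∧-true₂ _ _ I-indep)) ⟩
    1ℚ * 2ℚ ^ k                    ≡⟨ *-identityˡ _ ⟩
    2ℚ ^ k                         ∎
    where open ≡-Reasoning

  rank≤card : ∀ J → rank G J ℕ.≤ card J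
  rank≤card J with basis J
  ... | I , I-indep , |I|≡ρJ = subst (ℕ._≤ card J) |I|≡ρJ (⊆ᵇ⇒card≤ I J (∧-true₁ _ _ I-indep))

  rank≤rank-E : ∀ J → rank G J ℕ.≤ rank G E
  rank≤rank-E J with basis J
  ... | I , I-indep , |I|≡ρJ = subst (ℕ._≤ rank G E) |I|≡ρJ (card≤rank E I (cong₂ _∧_ (⊆ᵇ-full I) (∧-true₂ _ _ I-indep)))

  module _ (rows-indep : RowsIndependent G) where

    #vanishingOn-E : #vanishingOn E ≡ 1ℚ
    #vanishingOn-E = trans (∑-cong k only-zero) (∑-isZero-delta k 1ℚ)
      where
      only-zero : ∀ m → [ disjointᵇ (encode G m) E ]ℚ 1ℚ ≡ [ isZeroᵇ m ]ℚ 1ℚ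
      only-zero m rewrite disjointᵇ-full (encode G m) = cong (λ b → [ b ]ℚ 1ℚ) (≡true-ext
        (λ mG≡0 → subst (λ w → isZeroᵇ w ≡ true) (sym (rows-indep m (isZeroᵇ⇒≡replicate (encode G m) mG≡0))) (isZeroᵇ-replicate k))
        (λ m≡0 → subst (λ w → isZeroᵇ (encode G w) ≡ true) (sym (isZeroᵇ⇒≡replicate m m≡0))
                   (subst (λ w → isZeroᵇ w ≡ true) (sym (encode-replicate-false G)) (isZeroᵇ-replicate n))))

    rank-E : rank G E ≡ k
    rank-E = 2^-injective _ _ (trans (sym (*-identityʳ _))
      (trans (cong (2ℚ ^ rank G E *_) (sym #vanishingOn-E)) (2^rank*#vanishingOn E)))

    #vanishingOn≡2^corank : ∀ J → #vanishingOn J ≡ 2ℚ ^ (rank G E ∸ rank G J)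
    #vanishingOn≡2^corank J = *-cancelˡ-≢0 (2ℚ ^ rank G J) (positive⇒≢0 (2^-pos (rank G J))) (begin
      2ℚ ^ rank G J * #vanishingOn J                         ≡⟨ 2^rank*#vanishingOn J ⟩
      2ℚ ^ k                                                 ≡⟨ cong (2ℚ ^_) rank-E ⟨
      2ℚ ^ rank G E                                          ≡⟨ cong (2ℚ ^_) (ℕP.m+[n∸m]≡n (rank≤rank-E J)) ⟨
      2ℚ ^ (rank G J ℕ.+ (rank G E ∸ rank G J))              ≡⟨ ^-distribˡ-+-* 2ℚ (rank G J) _ ⟩
      2ℚ ^ rank G J * 2ℚ ^ (rank G E ∸ rank G J)             ∎)
      where open ≡-Reasoning

-- The binomial theorem over an interval of subsets

+[1+m]-s≡+m-[s-1] : ∀ m s → + suc m ℤ.- s ≡ + m ℤ.- (s ℤ.- + 1)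
+[1+m]-s≡+m-[s-1] m s = trans (cong (ℤ._- s) (ℤP.pos-+ 1 m))
  (ℤS.solve 2 (λ m s → (ℤS.con (+ 1) ℤS.:+ m) ℤS.:- s ℤS.:= m ℤS.:- (s ℤS.:- ℤS.con (+ 1))) refl (+ m) s)

t-+[1+m]≡[t-1]-+m : ∀ m t → t ℤ.- + suc m ≡ (t ℤ.- + 1) ℤ.- + m
t-+[1+m]≡[t-1]-+m m t = trans (cong (λ i → t ℤ.- i) (ℤP.pos-+ 1 m))
  (ℤS.solve 2 (λ m t → t ℤS.:- (ℤS.con (+ 1) ℤS.:+ m) ℤS.:= (t ℤS.:- ℤS.con (+ 1)) ℤS.:- m) refl (+ m) t)

+[1+m]-+[1+n]≡+m-+n : ∀ m n → + suc m ℤ.- + suc n ≡ + m ℤ.- + n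
+[1+m]-+[1+n]≡+m-+n m n = trans (ℤP.[+m]-[+n]≡m⊖n (suc m) (suc n))
  (trans (ℤP.[1+m]⊖[1+n]≡m⊖n m n) (sym (ℤP.[+m]-[+n]≡m⊖n m n)))

^ℤ-+1 : ∀ q → q ≢ 0ℚ → ∀ i → q ^ℤ (i ℤ.+ + 1) ≡ q ^ℤ i * q
^ℤ-+1 q q≢0 i = trans (^ℤ-distribˡ-+-* q q≢0 i (+ 1)) (cong (q ^ℤ i *_) (*-identityʳ q))

module Binomial (a y : ℚ) (a≢0 : a ≢ 0ℚ) (y≢0 : y ≢ 0ℚ) (a+y≢0 : a + y ≢ 0ℚ) where

  shift : ∀ {n} (Z K : Vec Bool n) s t J →
    [ (Z ⊆ᵇ J) ∧ (J ⊆ᵇ K) ]ℚ (a ^ℤ (+ suc (card J) ℤ.- s) * y ^ℤ (t ℤ.- + suc (card J)))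
      ≡ [ (Z ⊆ᵇ J) ∧ (J ⊆ᵇ K) ]ℚ (a ^ℤ (+ card J ℤ.- (s ℤ.- + 1)) * y ^ℤ ((t ℤ.- + 1) ℤ.- + card J))
  shift Z K s t J = cong [ (Z ⊆ᵇ J) ∧ (J ⊆ᵇ K) ]ℚ
    (cong₂ _*_ (cong (a ^ℤ_) (+[1+m]-s≡+m-[s-1] (card J) s)) (cong (y ^ℤ_) (t-+[1+m]≡[t-1]-+m (card J) t)))

  -- Only integer exponents keep the recursion free of truncated subtraction.
  binomial : ∀ n (Z K : Vec Bool n) (s t : ℤ) →
    ∑ n (λ J → [ (Z ⊆ᵇ J) ∧ (J ⊆ᵇ K) ]ℚ (a ^ℤ (+ card J ℤ.- s) * y ^ℤ (t ℤ.- + card J)))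
      ≡ [ Z ⊆ᵇ K ]ℚ (a ^ℤ (+ card Z ℤ.- s) * y ^ℤ (t ℤ.- + card K) * (a + y) ^ℤ (+ card K ℤ.- + card Z))
  binomial zero [] [] s t = trans (∑-[] _) (sym (*-identityʳ _))
  binomial (suc n) (false ∷ Z) (false ∷ K) s t = trans (∑-∷ n _)
    (trans (cong₂ _+_ (binomial n Z K s t) (∑-vanish n (λ J → []-∧-false (Z ⊆ᵇ J) _))) (+-identityʳ _))
  binomial (suc n) (true ∷ Z) (false ∷ K) s t = trans (∑-∷ n _)
    (trans (cong₂ _+_ (∑-0 n) (∑-vanish n (λ J → []-∧-false (Z ⊆ᵇ J) _))) (+-identityʳ 0ℚ))
  binomial (suc n) (true ∷ Z) (true ∷ K) s t = trans (∑-∷ n _)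
    (trans (cong₂ _+_ (∑-0 n) (trans (∑-cong n (shift Z K s t)) (binomial n Z K (s ℤ.- + 1) (t ℤ.- + 1))))
    (trans (+-identityˡ _) (cong [ Z ⊆ᵇ K ]ℚ (cong₂ _*_
      (cong₂ _*_ (cong (a ^ℤ_) (sym (+[1+m]-s≡+m-[s-1] (card Z) s))) (cong (y ^ℤ_) (sym (t-+[1+m]≡[t-1]-+m (card K) t))))
      (cong ((a + y) ^ℤ_) (sym (+[1+m]-+[1+n]≡+m-+n (card K) (card Z))))))))
  binomial (suc n) (false ∷ Z) (true ∷ K) s t = trans (∑-∷ n _)
    (trans (cong₂ _+_ (binomial n Z K s t) (trans (∑-cong n (shift Z K s t)) (binomial n Z K (s ℤ.- + 1) (t ℤ.- + 1))))
           combine)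
    where
    α β γ : ℚ
    α = a ^ℤ (+ card Z ℤ.- s)
    β = y ^ℤ ((t ℤ.- + 1) ℤ.- + card K)
    γ = (a + y) ^ℤ (+ card K ℤ.- + card Z)
    α′ : a ^ℤ (+ card Z ℤ.- (s ℤ.- + 1)) ≡ α * a
    α′ = trans (cong (a ^ℤ_) (ℤS.solve 2 (λ z s → z ℤS.:- (s ℤS.:- ℤS.con (+ 1)) ℤS.:= (z ℤS.:- s) ℤS.:+ ℤS.con (+ 1)) refl (+ card Z) s))
               (^ℤ-+1 a a≢0 (+ card Z ℤ.- s))
    β′ : y ^ℤ (t ℤ.- + card K) ≡ β * y
    β′ = trans (cong (y ^ℤ_) (ℤS.solve 2 (λ t k → t ℤS.:- k ℤS.:= ((t ℤS.:- ℤS.con (+ 1)) ℤS.:- k) ℤS.:+ ℤS.con (+ 1)) refl t (+ card K)))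
               (^ℤ-+1 y y≢0 ((t ℤ.- + 1) ℤ.- + card K))
    γ′ : (a + y) ^ℤ (+ suc (card K) ℤ.- + card Z) ≡ γ * (a + y)
    γ′ = trans (cong ((a + y) ^ℤ_) (ℤS.solve 2 (λ k z → (ℤS.con (+ 1) ℤS.:+ k) ℤS.:- z ℤS.:= (k ℤS.:- z) ℤS.:+ ℤS.con (+ 1)) refl (+ card K) (+ card Z)))
               (^ℤ-+1 (a + y) a+y≢0 (+ card K ℤ.- + card Z))
    combine : [ Z ⊆ᵇ K ]ℚ (α * y ^ℤ (t ℤ.- + card K) * γ) + [ Z ⊆ᵇ K ]ℚ (a ^ℤ (+ card Z ℤ.- (s ℤ.- + 1)) * β * γ)
            ≡ [ Z ⊆ᵇ K ]ℚ (α * y ^ℤ (t ℤ.- + suc (card K)) * (a + y) ^ℤ (+ suc (card K) ℤ.- + card Z))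
    combine rewrite α′ | β′ | γ′ | t-+[1+m]≡[t-1]-+m (card K) t with Z ⊆ᵇ K
    ... | false = +-identityʳ 0ℚ
    ... | true  = solve 5 (λ α β γ a y → α :* (β :* y) :* γ :+ α :* a :* β :* γ := α :* β :* (γ :* (a :+ y))) refl α β γ a y

  f̃-binomial : ∀ {n} d (f : Vec Bool n → ℚ) (t : ℤ) K → let open Harmonic d f in
    ∑ n (λ J → [ J ⊆ᵇ K ]ℚ (f̃ J * (a ^ℤ (+ card J ℤ.- + d) * y ^ℤ (t ℤ.- + card J))))
      ≡ f̃ K * (y ^ℤ (t ℤ.- + card K) * (a + y) ^ℤ (+ card K ℤ.- + d))
  f̃-binomial {n} d f t K = begin
    ∑ n (λ J → [ J ⊆ᵇ K ]ℚ (f̃ J * w J))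
      ≡⟨ ∑-cong n (λ J → trans (cong [ J ⊆ᵇ K ]ℚ (sym (∑-*ʳ n (w J) _))) ([]-∑ n (J ⊆ᵇ K) _)) ⟩
    ∑ n (λ J → ∑ n (λ Z → [ J ⊆ᵇ K ]ℚ ([ (card Z ≡ᵇ d) ∧ (Z ⊆ᵇ J) ]ℚ (f Z) * w J)))
      ≡⟨ ∑-swap n n _ ⟩
    ∑ n (λ Z → ∑ n (λ J → [ J ⊆ᵇ K ]ℚ ([ (card Z ≡ᵇ d) ∧ (Z ⊆ᵇ J) ]ℚ (f Z) * w J)))
      ≡⟨ ∑-cong n (λ Z → ∑-cong n (λ J → regroup (J ⊆ᵇ K) (card Z ≡ᵇ d) (Z ⊆ᵇ J) (f Z) (w J))) ⟩
    ∑ n (λ Z → ∑ n (λ J → [ card Z ≡ᵇ d ]ℚ (f Z) * [ (Z ⊆ᵇ J) ∧ (J ⊆ᵇ K) ]ℚ (w J)))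
      ≡⟨ ∑-cong n (λ Z → trans (∑-*ˡ n ([ card Z ≡ᵇ d ]ℚ (f Z)) (λ J → [ (Z ⊆ᵇ J) ∧ (J ⊆ᵇ K) ]ℚ (w J))) (cong ([ card Z ≡ᵇ d ]ℚ (f Z) *_) (binomial n Z K (+ d) t))) ⟩
    ∑ n (λ Z → [ card Z ≡ᵇ d ]ℚ (f Z) * [ Z ⊆ᵇ K ]ℚ (a ^ℤ (+ card Z ℤ.- + d) * yK * (a + y) ^ℤ (+ card K ℤ.- + card Z)))
      ≡⟨ ∑-cong n only-d-sets ⟩
    ∑ n (λ Z → [ (card Z ≡ᵇ d) ∧ (Z ⊆ᵇ K) ]ℚ (f Z) * (yK * (a + y) ^ℤ (+ card K ℤ.- + d)))
      ≡⟨ ∑-*ʳ n _ _ ⟩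
    f̃ K * (yK * (a + y) ^ℤ (+ card K ℤ.- + d)) ∎
    where
    open ≡-Reasoning
    open Harmonic d f
    w : Vec Bool n → ℚ
    w J = a ^ℤ (+ card J ℤ.- + d) * y ^ℤ (t ℤ.- + card J)
    yK : ℚ
    yK = y ^ℤ (t ℤ.- + card K)
    regroup : ∀ j e z q r → [ j ]ℚ ([ e ∧ z ]ℚ q * r) ≡ [ e ]ℚ q * [ z ∧ j ]ℚ r
    regroup false e     false q r = sym (*-zeroʳ ([ e ]ℚ q))
    regroup false e     true  q r = sym (*-zeroʳ ([ e ]ℚ q))
    regroup true  false z     q r = trans (*-zeroˡ r) (sym (*-zeroˡ ([ z ∧ true ]ℚ r)))
    regroup true  true  false q r = trans (*-zeroˡ r) (sym (*-zeroʳ q))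
    regroup true  true  true  q r = refl
    only-d-sets : ∀ Z → [ card Z ≡ᵇ d ]ℚ (f Z) * [ Z ⊆ᵇ K ]ℚ (a ^ℤ (+ card Z ℤ.- + d) * yK * (a + y) ^ℤ (+ card K ℤ.- + card Z))
                      ≡ [ (card Z ≡ᵇ d) ∧ (Z ⊆ᵇ K) ]ℚ (f Z) * (yK * (a + y) ^ℤ (+ card K ℤ.- + d))
    only-d-sets Z with card Z ≡ᵇ d in |Z|≡ᵇd
    ... | false = trans (*-zeroˡ ([ Z ⊆ᵇ K ]ℚ (a ^ℤ (+ card Z ℤ.- + d) * yK * (a + y) ^ℤ (+ card K ℤ.- + card Z)))) (sym (*-zeroˡ (yK * (a + y) ^ℤ (+ card K ℤ.- + d))))
    ... | true with ≡ᵇ⇒≡ (card Z) d |Z|≡ᵇd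
    ... | refl with Z ⊆ᵇ K
    ... | false = trans (*-zeroʳ (f Z)) (sym (*-zeroˡ (yK * (a + y) ^ℤ (+ card K ℤ.- + card Z))))
    ... | true  rewrite ℤP.+-inverseʳ (+ card Z) = cong (f Z *_) (cong (_* ((a + y) ^ℤ (+ card K ℤ.- + card Z))) (*-identityˡ yK))

-- The weight enumerator as a sum over messages

zMonomial : (n d : ℕ) (x y : ℚ) → ℕ → ℚ
zMonomial n d x y i = x ^ℤ (+ n ℤ.- + i ℤ.- + d) * y ^ℤ (+ i ℤ.- + d)

Zpoly-as-∑ : ∀ {k n} (G : Vec (Vec Bool n) k) d f x y →
  Zpoly G d f x y ≡ ∑ k (λ m → ftilde d f (encode G m) * zMonomial n d x y (card (encode G m)))
Zpoly-as-∑ {k} {n} G d f x y = begin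
  ∑L (map toℕ (allFin (suc n))) (λ i → Acoef G d f i * x^ i * y^ i)
    ≡⟨ cong (λ l → ∑L l (λ i → Acoef G d f i * x^ i * y^ i)) (ListP.map-tabulate {n = suc n} id toℕ) ⟩
  ∑L L (λ i → Acoef G d f i * x^ i * y^ i)
    ≡⟨ ∑L-cong L (λ i → trans (*-assoc (Acoef G d f i) (x^ i) (y^ i)) (trans (cong (_* monomial i) (Acoef-as-∑ i)) (sym (∑L-*ʳ (allVecs k) (monomial i) _)))) ⟩
  ∑L L (λ i → ∑L (allVecs k) (λ m → [ card (encode G m) ≡ᵇ i ]ℚ (ftilde d f (encode G m)) * monomial i))
    ≡⟨ ∑L-swap L (allVecs k) (λ i m → [ card (encode G m) ≡ᵇ i ]ℚ (ftilde d f (encode G m)) * monomial i) ⟩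
  ∑L (allVecs k) (λ m → ∑L L (λ i → [ card (encode G m) ≡ᵇ i ]ℚ (ftilde d f (encode G m)) * monomial i))
    ≡⟨ ∑L-cong (allVecs k) (λ m → ∑L-cong L (λ i → []-*ʳ (card (encode G m) ≡ᵇ i) (ftilde d f (encode G m)) (monomial i))) ⟩
  ∑L (allVecs k) (λ m → ∑L L (λ i → [ card (encode G m) ≡ᵇ i ]ℚ (ftilde d f (encode G m) * monomial i)))
    ≡⟨ ∑L-cong (allVecs k) (λ m → ∑L-upTo-delta (suc n) (card (encode G m)) (s≤s (card≤n (encode G m))) (λ i → ftilde d f (encode G m) * monomial i)) ⟩
  ∑L (allVecs k) (λ m → ftilde d f (encode G m) * monomial (card (encode G m)))
    ≡⟨ ∑-unfold k _ ⟨
  ∑ k (λ m → ftilde d f (encode G m) * zMonomial n d x y (card (encode G m))) ∎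
  where
  open ≡-Reasoning
  L : List ℕ
  L = tabulate {n = suc n} toℕ
  x^ y^ monomial : ℕ → ℚ
  x^ i = x ^ℤ (+ n ℤ.- + i ℤ.- + d)
  y^ i = y ^ℤ (+ i ℤ.- + d)
  monomial = zMonomial n d x y
  Acoef-as-∑ : ∀ i → Acoef G d f i ≡ ∑L (allVecs k) (λ m → [ card (encode G m) ≡ᵇ i ]ℚ (ftilde d f (encode G m)))
  Acoef-as-∑ i = trans (∑L-filter (λ u → card u ≡ᵇ i) (codewords G) (ftilde d f))
                       (∑L-map (encode G) (allVecs k) (λ u → [ card u ≡ᵇ i ]ℚ (ftilde d f u)))

disjointᵇ≡⊆ᵇ∁ : ∀ {n} (u J : Vec Bool n) → disjointᵇ u J ≡ J ⊆ᵇ ∁ u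
disjointᵇ≡⊆ᵇ∁ []          []          = refl
disjointᵇ≡⊆ᵇ∁ (false ∷ u) (false ∷ J) = disjointᵇ≡⊆ᵇ∁ u J
disjointᵇ≡⊆ᵇ∁ (false ∷ u) (true ∷ J)  = disjointᵇ≡⊆ᵇ∁ u J
disjointᵇ≡⊆ᵇ∁ (true ∷ u)  (false ∷ J) = disjointᵇ≡⊆ᵇ∁ u J
disjointᵇ≡⊆ᵇ∁ (true ∷ u)  (true ∷ J)  = refl

+[n∸m]≡+n-+m : ∀ {m n} → m ℕ.≤ n → + (n ∸ m) ≡ + n ℤ.- + m
+[n∸m]≡+n-+m {m} {n} m≤n = trans (sym (ℤP.⊖-≥ m≤n)) (sym (ℤP.m-n≡m⊖n n m))

+card-∁ : ∀ {n} (u : Vec Bool n) → + card (∁ u) ≡ + n ℤ.- + card u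
+card-∁ u = trans (cong +_ (trans (sym (ℕP.m+n∸n≡m (card (∁ u)) (card u))) (cong (_∸ card u) (card-∁ u))))
                  (+[n∸m]≡+n-+m (card≤n u))

^ℤ-+-+ : ∀ q → q ≢ 0ℚ → ∀ i j l → q ^ℤ (i ℤ.+ j ℤ.+ l) ≡ q ^ℤ i * q ^ℤ j * q ^ℤ l
^ℤ-+-+ q q≢0 i j l = trans (^ℤ-distribˡ-+-* q q≢0 (i ℤ.+ j) l) (cong (_* q ^ℤ l) (^ℤ-distribˡ-+-* q q≢0 i j))

module Evaluation {n k : ℕ} (d : ℕ) (G : Vec (Vec Bool n) k) (rows-indep : RowsIndependent G)
                  (f : Vec Bool n → ℚ) (harm : IsHarmonic d f)
                  (x y : ℚ) (x≢0 : x ≢ 0ℚ) (y≢0 : y ≢ 0ℚ) (x≢y : x ≢ y) where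
  open Harmonic d f
  open Code G
  open Rank G

  a : ℚ
  a = x - y

  a+y≡x : a + y ≡ x
  a+y≡x = solve 2 (λ x y → (x :+ (:- y)) :+ y := x) refl x y

  a≢0 : a ≢ 0ℚ
  a≢0 a≡0 = x≢y (trans (sym a+y≡x) (trans (cong (_+ y) a≡0) (+-identityˡ y)))

  a+y≢0 : a + y ≢ 0ℚ
  a+y≢0 a+y≡0 = x≢0 (trans (sym a+y≡x) a+y≡0)

  open Binomial a y a≢0 y≢0 a+y≢0

  weight : Vec Bool n → ℚ
  weight u = zMonomial n d x y (card u)

  ayMonomial : Vec Bool n → ℚ
  ayMonomial J = a ^ℤ (+ card J ℤ.- + d) * y ^ℤ ((+ n ℤ.- + d) ℤ.- + card J)

  term : Vec Bool n → ℚ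
  term J = (- 1ℚ) ^ d * (f̃ J * ayMonomial J)

  ∑-disjoint-term : ∀ u → ∑ n (λ J → [ disjointᵇ u J ]ℚ 1ℚ * term J) ≡ f̃ u * weight u
  ∑-disjoint-term u = begin
    ∑ n (λ J → [ disjointᵇ u J ]ℚ 1ℚ * term J)
      ≡⟨ ∑-cong n (λ J → trans (cong (λ b → [ b ]ℚ 1ℚ * term J) (disjointᵇ≡⊆ᵇ∁ u J)) (pull-sign (J ⊆ᵇ ∁ u) (f̃ J * ayMonomial J))) ⟩
    ∑ n (λ J → ±1 * [ J ⊆ᵇ ∁ u ]ℚ (f̃ J * ayMonomial J))
      ≡⟨ ∑-*ˡ n ±1 _ ⟩
    ±1 * ∑ n (λ J → [ J ⊆ᵇ ∁ u ]ℚ (f̃ J * ayMonomial J))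
      ≡⟨ cong (±1 *_) (f̃-binomial d f (+ n ℤ.- + d) (∁ u)) ⟩
    ±1 * (f̃ (∁ u) * P)
      ≡⟨ cong (λ s → ±1 * (s * P)) f̃-∁u ⟩
    ±1 * ((±1 * f̃ u) * P)
      ≡⟨ solve 3 (λ m F P → m :* ((m :* F) :* P) := (m :* m) :* (F :* P)) refl ±1 (f̃ u) P ⟩
    (±1 * ±1) * (f̃ u * P)
      ≡⟨ cong (_* (f̃ u * P)) ([-1]^n*[-1]^n≡1 d) ⟩
    1ℚ * (f̃ u * P)
      ≡⟨ *-identityˡ _ ⟩
    f̃ u * P
      ≡⟨ cong (f̃ u *_) P≡weight ⟩
    f̃ u * weight u ∎
    where
    open ≡-Reasoning
    ±1 P : ℚ
    ±1 = (- 1ℚ) ^ d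
    P = y ^ℤ ((+ n ℤ.- + d) ℤ.- + card (∁ u)) * (a + y) ^ℤ (+ card (∁ u) ℤ.- + d)
    pull-sign : ∀ b q → [ b ]ℚ 1ℚ * (±1 * q) ≡ ±1 * [ b ]ℚ q
    pull-sign false q = trans (*-zeroˡ (±1 * q)) (sym (*-zeroʳ ±1))
    pull-sign true  q = *-identityˡ (±1 * q)
    f̃-∁u : f̃ (∁ u) ≡ ±1 * f̃ u
    f̃-∁u = trans (f̃-∁ harm (∁ u)) (cong (λ v → ±1 * f̃ v) (∁-involutive u))
    P≡weight : P ≡ weight u
    P≡weight = trans (*-comm (y ^ℤ ((+ n ℤ.- + d) ℤ.- + card (∁ u))) ((a + y) ^ℤ (+ card (∁ u) ℤ.- + d))) (cong₂ _*_
      (trans (cong (_^ℤ (+ card (∁ u) ℤ.- + d)) a+y≡x) (cong (λ i → x ^ℤ (i ℤ.- + d)) (+card-∁ u)))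
      (cong (y ^ℤ_) (trans (cong (λ i → (+ n ℤ.- + d) ℤ.- i) (+card-∁ u))
        (ℤS.solve 3 (λ n d c → (n ℤS.:- d) ℤS.:- (n ℤS.:- c) ℤS.:= c ℤS.:- d) refl (+ n) (+ d) (+ card u)))))

  X-1≡2y/a : (x + y) ÷' (x - y) + - 1ℚ ≡ 2ℚ * y * inv a
  X-1≡2y/a = begin
    (x + y) * inv a + - 1ℚ                   ≡⟨ cong (λ z → (x + y) * inv a + - z) (inv-inverseʳ a a≢0) ⟨
    (x + y) * inv a + - ((x + - y) * inv a)  ≡⟨ solve 3 (λ x y i → (x :+ y) :* i :+ (:- ((x :+ (:- y)) :* i)) := (con 1ℚ :+ con 1ℚ) :* y :* i) refl x y (inv a) ⟩
    2ℚ * y * inv a                           ∎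
    where open ≡-Reasoning

  Y-1≡a/y : x ÷' y + - 1ℚ ≡ a * inv y
  Y-1≡a/y = begin
    x * inv y + - 1ℚ           ≡⟨ cong (λ z → x * inv y + - z) (inv-inverseʳ y y≢0) ⟨
    x * inv y + - (y * inv y)  ≡⟨ solve 3 (λ x y i → x :* i :+ (:- (y :* i)) := (x :+ (:- y)) :* i) refl x y (inv y) ⟩
    a * inv y                  ∎
    where open ≡-Reasoning

  prefactor : ℚ
  prefactor = (- 1ℚ) ^ d * a ^ℤ (+ k ℤ.- + d) * y ^ℤ (+ n ℤ.- + k ℤ.- + d)

  tutteSummand : Vec Bool n → ℚ
  tutteSummand J = ftilde d f J * ((x + y) ÷' (x - y) + - 1ℚ) ^ (rank G E ∸ rank G J)
                                * (x ÷' y + - 1ℚ) ^ (card J ∸ rank G J)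

  +corank≡ : ∀ J → + (rank G E ∸ rank G J) ≡ + k ℤ.- + rank G J
  +corank≡ J = trans (+[n∸m]≡+n-+m (rank≤rank-E J)) (cong (λ r → + r ℤ.- + rank G J) (rank-E rows-indep))

  +nullity≡ : ∀ J → + (card J ∸ rank G J) ≡ + card J ℤ.- + rank G J
  +nullity≡ J = +[n∸m]≡+n-+m (rank≤card J)

  a-exponents : ∀ J → a ^ℤ (+ k ℤ.- + d) * inv a ^ (rank G E ∸ rank G J) * a ^ (card J ∸ rank G J)
                     ≡ a ^ℤ (+ card J ℤ.- + d)
  a-exponents J = begin
    a ^ℤ (+ k ℤ.- + d) * inv a ^ (rank G E ∸ rank G J) * a ^ (card J ∸ rank G J)
      ≡⟨ cong (λ z → a ^ℤ (+ k ℤ.- + d) * z * a ^ (card J ∸ rank G J)) (^ℤ-neg a (rank G E ∸ rank G J)) ⟨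
    a ^ℤ (+ k ℤ.- + d) * a ^ℤ (ℤ.- + (rank G E ∸ rank G J)) * a ^ℤ (+ (card J ∸ rank G J))
      ≡⟨ ^ℤ-+-+ a a≢0 (+ k ℤ.- + d) (ℤ.- + (rank G E ∸ rank G J)) (+ (card J ∸ rank G J)) ⟨
    a ^ℤ ((+ k ℤ.- + d) ℤ.+ ℤ.- + (rank G E ∸ rank G J) ℤ.+ + (card J ∸ rank G J))
      ≡⟨ cong (a ^ℤ_) (trans (cong₂ (λ u v → (+ k ℤ.- + d) ℤ.+ ℤ.- u ℤ.+ v) (+corank≡ J) (+nullity≡ J))
           (ℤS.solve 4 (λ k d r c → (k ℤS.:- d) ℤS.:+ (ℤS.:- (k ℤS.:- r)) ℤS.:+ (c ℤS.:- r) ℤS.:= c ℤS.:- d) refl (+ k) (+ d) (+ rank G J) (+ card J))) ⟩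
    a ^ℤ (+ card J ℤ.- + d) ∎
    where open ≡-Reasoning

  y-exponents : ∀ J → y ^ℤ (+ n ℤ.- + k ℤ.- + d) * y ^ (rank G E ∸ rank G J) * inv y ^ (card J ∸ rank G J)
                     ≡ y ^ℤ ((+ n ℤ.- + d) ℤ.- + card J)
  y-exponents J = begin
    y ^ℤ (+ n ℤ.- + k ℤ.- + d) * y ^ (rank G E ∸ rank G J) * inv y ^ (card J ∸ rank G J)
      ≡⟨ cong (λ z → y ^ℤ (+ n ℤ.- + k ℤ.- + d) * y ^ (rank G E ∸ rank G J) * z) (^ℤ-neg y (card J ∸ rank G J)) ⟨
    y ^ℤ (+ n ℤ.- + k ℤ.- + d) * y ^ℤ (+ (rank G E ∸ rank G J)) * y ^ℤ (ℤ.- + (card J ∸ rank G J))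
      ≡⟨ ^ℤ-+-+ y y≢0 (+ n ℤ.- + k ℤ.- + d) (+ (rank G E ∸ rank G J)) (ℤ.- + (card J ∸ rank G J)) ⟨
    y ^ℤ ((+ n ℤ.- + k ℤ.- + d) ℤ.+ + (rank G E ∸ rank G J) ℤ.+ ℤ.- + (card J ∸ rank G J))
      ≡⟨ cong (y ^ℤ_) (trans (cong₂ (λ u v → (+ n ℤ.- + k ℤ.- + d) ℤ.+ u ℤ.+ ℤ.- v) (+corank≡ J) (+nullity≡ J))
           (ℤS.solve 5 (λ n k d r c → (n ℤS.:- k ℤS.:- d) ℤS.:+ (k ℤS.:- r) ℤS.:+ (ℤS.:- (c ℤS.:- r)) ℤS.:= (n ℤS.:- d) ℤS.:- c) refl (+ n) (+ k) (+ d) (+ rank G J) (+ card J))) ⟩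
    y ^ℤ ((+ n ℤ.- + d) ℤ.- + card J) ∎
    where open ≡-Reasoning

  prefactor*tutteSummand : ∀ J → prefactor * tutteSummand J ≡ #vanishingOn J * term J
  prefactor*tutteSummand J = begin
    prefactor * (ftilde d f J * X-1 ^ e₁ * Y-1 ^ e₂)
      ≡⟨ cong (prefactor *_) (cong₂ _*_ (cong₂ (λ u v → u * v ^ e₁) (ftilde≡f̃ J) X-1≡2y/a) (cong (_^ e₂) Y-1≡a/y)) ⟩
    prefactor * (f̃ J * (2ℚ * y * inv a) ^ e₁ * (a * inv y) ^ e₂)
      ≡⟨ cong (prefactor *_) (cong₂ (λ u v → f̃ J * u * v)
           (trans (^-distribʳ-* (2ℚ * y) (inv a) e₁) (cong (_* inv a ^ e₁) (^-distribʳ-* 2ℚ y e₁)))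
           (^-distribʳ-* a (inv y) e₂)) ⟩
    prefactor * (f̃ J * (2ℚ ^ e₁ * y ^ e₁ * inv a ^ e₁) * (a ^ e₂ * inv y ^ e₂))
      ≡⟨ solve 9 (λ m A Y F t ye ia ae iy → ((m :* A) :* Y) :* ((F :* ((t :* ye) :* ia)) :* (ae :* iy))
                                           := t :* (m :* (F :* (((A :* ia) :* ae) :* ((Y :* ye) :* iy)))))
           refl ((- 1ℚ) ^ d) (a ^ℤ (+ k ℤ.- + d)) (y ^ℤ (+ n ℤ.- + k ℤ.- + d)) (f̃ J) (2ℚ ^ e₁) (y ^ e₁) (inv a ^ e₁) (a ^ e₂) (inv y ^ e₂) ⟩
    2ℚ ^ e₁ * ((- 1ℚ) ^ d * (f̃ J * ((a ^ℤ (+ k ℤ.- + d) * inv a ^ e₁ * a ^ e₂) * (y ^ℤ (+ n ℤ.- + k ℤ.- + d) * y ^ e₁ * inv y ^ e₂))))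
      ≡⟨ cong₂ (λ u v → 2ℚ ^ e₁ * ((- 1ℚ) ^ d * (f̃ J * (u * v)))) (a-exponents J) (y-exponents J) ⟩
    2ℚ ^ e₁ * term J
      ≡⟨ cong (_* term J) (#vanishingOn≡2^corank rows-indep J) ⟨
    #vanishingOn J * term J ∎
    where
    open ≡-Reasoning
    X-1 Y-1 : ℚ
    X-1 = (x + y) ÷' (x - y) + - 1ℚ
    Y-1 = x ÷' y + - 1ℚ
    e₁ e₂ : ℕ
    e₁ = rank G E ∸ rank G J
    e₂ = card J ∸ rank G J

  prefactor*harmTutte : prefactor * harmTutte G d f ((x + y) ÷' (x - y)) (x ÷' y)
                      ≡ ∑ k (λ m → f̃ (encode G m) * weight (encode G m))
  prefactor*harmTutte = begin
    prefactor * ∑L (allVecs n) tutteSummand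
      ≡⟨ cong (prefactor *_) (∑-unfold n tutteSummand) ⟨
    prefactor * ∑ n tutteSummand
      ≡⟨ ∑-*ˡ n prefactor tutteSummand ⟨
    ∑ n (λ J → prefactor * tutteSummand J)
      ≡⟨ ∑-cong n prefactor*tutteSummand ⟩
    ∑ n (λ J → #vanishingOn J * term J)
      ≡⟨ ∑-cong n (λ J → ∑-*ʳ k (term J) _) ⟨
    ∑ n (λ J → ∑ k (λ m → [ disjointᵇ (encode G m) J ]ℚ 1ℚ * term J))
      ≡⟨ ∑-swap n k _ ⟩
    ∑ k (λ m → ∑ n (λ J → [ disjointᵇ (encode G m) J ]ℚ 1ℚ * term J))
      ≡⟨ ∑-cong k (∑-disjoint-term ∘ encode G) ⟩
    ∑ k (λ m → f̃ (encode G m) * weight (encode G m)) ∎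
    where open ≡-Reasoning

theorem4p3 : (n k d : ℕ) (G : Vec (Vec Bool n) k) → RowsIndependent G →
    (f : Vec Bool n → ℚ) → IsHarmonic d f →
    (x y : ℚ) → x ≢ 0ℚ → y ≢ 0ℚ → x ≢ y →
    Zpoly G d f x y
      ≡ ((- 1ℚ) ^ d) * ((x - y) ^ℤ ((+ k) ℤ.- (+ d))) * (y ^ℤ ((+ n) ℤ.- (+ k) ℤ.- (+ d)))
        * harmTutte G d f ((x + y) ÷' (x - y)) (x ÷' y)
theorem4p3 n k d G rows-indep f harm x y x≢0 y≢0 x≢y = begin
  Zpoly G d f x y                                                   ≡⟨ Zpoly-as-∑ G d f x y ⟩
  ∑ k (λ m → ftilde d f (encode G m) * weight (encode G m))         ≡⟨ ∑-cong k (λ m → cong (_* weight (encode G m)) (ftilde≡f̃ (encode G m))) ⟩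
  ∑ k (λ m → f̃ (encode G m) * weight (encode G m))                  ≡⟨ prefactor*harmTutte ⟨
  prefactor * harmTutte G d f ((x + y) ÷' (x - y)) (x ÷' y)         ∎
  where
  open ≡-Reasoning
  open Evaluation d G rows-indep f harm x y x≢0 y≢0 x≢y
  open Harmonic d f using (f̃; ftilde≡f̃)
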